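{- Let $G\cong GL(3,2)$ and let $M$ be a 3-dimensional irreducible $\mathbb{F}_2G$-module. (i) If $f:G\to M$ is a nonzero inner derivation, then $\mathrm{Im}(f)$ is a 7-element subset of $M$ containing $0$, and if $a\in M\setminus\mathrm{Im}(f)$ then $f$ is the inner derivation determined by $a$, namely $x\mapsto a^{x^{ -1}}-a$. (ii) If $f:G\to M$ is a noninner derivation, then $\mathrm{Im}(f)=M$ and $\ker(f)=\{x\in G:f(x)=0\}$ is isomorphic to the Frobenius group $7{:}3$ of order 21.
   Context: $M$ is a right $G$-module, action written $a\mapsto a^x$. A derivation (1-cocycle) is a map $f:G\to M$ with $f(xy)=f(x)+f(y)^{x^{ -1}}$; the inner derivations are those of the form $x\mapsto a^{x^{ -1}}-a$ for a fixed $a\in M$; a noninner derivation is one not of this form. -}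

module Defs where

open import Level using (Level)
open import Data.Bool using (Bool; true; false; _xor_; _∧_)
open import Data.Fin using (Fin; zero; suc; toℕ)
open import Data.Nat using (ℕ; _+_; _*_; _^_; _%_)
open import Data.Nat.DivMod using (_mod_)
open import Data.Vec using (Vec; lookup; tabulate; replicate; zipWith)
open import Data.Product using (Σ; ∃; _×_; _,_)
open import Data.Sum using (_⊎_)
open import Data.List using (List; length)
open import Data.List.Relation.Unary.Unique.Propositional using (Unique)
open import Data.List.Membership.Propositional using (_∈_)
open import Relation.Binary.PropositionalEquality using (_≡_)
open import Relation.Nullary using (¬_)
open import Algebra.Bundles using (Group)

-- The field F₂ = Bool (addition = xor, multiplication = ∧) and F₂³.

V3 : Set
V3 = Vec Bool 3

0v : V3
0v = replicate 3 false

_+v_ : V3 → V3 → V3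
_+v_ = zipWith _xor_

-- subtraction in F₂³; in characteristic 2 it coincides with addition
_-v_ : V3 → V3 → V3
_-v_ = zipWith _xor_

Mat3 : Set
Mat3 = Vec (Vec Bool 3) 3

_*M_ : Mat3 → Mat3 → Mat3
A *M B = tabulate λ i → tabulate λ j →
  ((lookup (lookup A i) zero ∧ lookup (lookup B zero) j)
   xor (lookup (lookup A i) (suc zero) ∧ lookup (lookup B (suc zero)) j))
   xor (lookup (lookup A i) (suc (suc zero)) ∧ lookup (lookup B (suc (suc zero))) j)

I3 : Mat3
I3 = tabulate λ i → tabulate λ j → isEq i j
  where
  isEq : {n : ℕ} → Fin n → Fin n → Bool
  isEq zero zero = true
  isEq zero (suc _) = false
  isEq (suc _) zero = false
  isEq (suc i) (suc j) = isEq i j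

InvertibleM : Mat3 → Set
InvertibleM A = Σ Mat3 λ B → (A *M B ≡ I3) × (B *M A ≡ I3)

record IsoGL32 {c ℓ : Level} (G : Group c ℓ) : Set (c Level.⊔ ℓ) where
  open Group G
  field
    φ         : Carrier → Mat3
    φ-cong    : ∀ {x y} → x ≈ y → φ x ≡ φ y
    φ-inv     : ∀ x → InvertibleM (φ x)
    φ-hom     : ∀ x y → φ (x ∙ y) ≡ φ x *M φ y
    φ-inj     : ∀ {x y} → φ x ≡ φ y → x ≈ y
    φ-surj    : ∀ A → InvertibleM A → ∃ λ x → φ x ≡ A

-- The Frobenius group 7:3 = Z₇ ⋊ Z₃, where the generator of Z₃ acts on
-- Z₇ by multiplication by 2 (an element of order 3 mod 7):
--   (a , i) · (b , j) = (a + 2^i b mod 7 , i + j mod 3).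

F21 : Set
F21 = Fin 7 × Fin 3

_·F21_ : F21 → F21 → F21
(a , i) ·F21 (b , j) =
  ((toℕ a + (2 ^ toℕ i) * toℕ b) mod 7 , (toℕ i + toℕ j) mod 3)

-- Right F₂G-modules with underlying space F₂³ (action written a ^ x).

record Module3 {c ℓ : Level} (G : Group c ℓ) : Set (c Level.⊔ ℓ) where
  open Group G
  field
    act      : V3 → Carrier → V3
    act-cong : ∀ a {x y} → x ≈ y → act a x ≡ act a y
    act-ε    : ∀ a → act a ε ≡ a
    act-∙    : ∀ a x y → act a (x ∙ y) ≡ act (act a x) y
    -- F₂-linearity (additivity suffices over F₂)
    act-+    : ∀ a b x → act (a +v b) x ≡ act a x +v act b x

Irreducible : {c ℓ : Level} {G : Group c ℓ} → Module3 G → Set (Level.suc Level.zero Level.⊔ c)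
Irreducible {G = G} M =
  (S : V3 → Set) →
  S 0v →
  (∀ a b → S a → S b → S (a +v b)) →
  (∀ a x → S a → S (act a x)) →
  (∀ a → S a → a ≡ 0v) ⊎ (∀ a → S a)
  where open Module3 M
        open Group G

module _ {c ℓ : Level} {G : Group c ℓ} (M : Module3 G) where
  open Group G
  open Module3 M

  IsDerivation : (Carrier → V3) → Set (c Level.⊔ ℓ)
  IsDerivation f = (∀ {x y} → x ≈ y → f x ≡ f y) ×
                   (∀ x y → f (x ∙ y) ≡ f x +v act (f y) (x ⁻¹))

  IsInnerBy : (Carrier → V3) → V3 → Set c
  IsInnerBy f a = ∀ x → f x ≡ act a (x ⁻¹) -v a

  IsInner : (Carrier → V3) → Set c
  IsInner f = ∃ λ a → IsInnerBy f a

  InImage : (Carrier → V3) → V3 → Set c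
  InImage f b = ∃ λ x → f x ≡ b

  KerIsoF21 : (Carrier → V3) → Set (c Level.⊔ ℓ)
  KerIsoF21 f = Σ (Carrier → F21) λ ψ →
    (∀ {x y} → f x ≡ 0v → f y ≡ 0v → x ≈ y → ψ x ≡ ψ y) ×
    (∀ x y → f x ≡ 0v → f y ≡ 0v → ψ (x ∙ y) ≡ ψ x ·F21 ψ y) ×
    (∀ {x y} → f x ≡ 0v → f y ≡ 0v → ψ x ≡ ψ y → x ≈ y) ×
    (∀ t → ∃ λ x → (f x ≡ 0v) × (ψ x ≡ t))

HasCard : {c : Level} → (V3 → Set c) → ℕ → Set c
HasCard P n = Σ (List V3) λ xs →
  Unique xs × (length xs ≡ n) × (∀ b → (P b → b ∈ xs) × (b ∈ xs → P b))

module Submission where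

-- Writing the action as a row vector times a matrix turns M into a representation ρ of G
-- on F₂³. Its kernel is normal in the simple group G ≅ GL(3,2), and irreducibility rules out
-- ρ = 1, so ρ is faithful and, by counting, an isomorphism onto GL(3,2): M is the natural
-- module. A derivation f is then determined by its values at the preimages σ, τ of two
-- generators S, T of GL(3,2), and the relators S² = T³ = 1 leave sixteen candidates. Every
-- fact about GL(3,2) used is decided by computation over its 168 elements: eight candidates
-- are inner, and the other eight are onto with kernel a copy of 7:3. An inner derivation
-- x ↦ c^{x⁻¹} - c with c ≠ 0 has image M ∖ {c}, as GL(3,2) is transitive on nonzero vectors.


open import Defs
open import Level using (Level; 0ℓ)
open import Algebra.Bundles using (Group)
open import Algebra.Bundles.Raw using (RawMonoid)
open import Algebra.Morphism.Structures using (module MonoidMorphisms)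
open import Data.Bool using (Bool; true; false; _∧_; _xor_)
open import Data.Bool.Properties using (xor-same; xor-identityʳ; xor-∧-commutativeRing)
import Data.Bool.Properties as Boolₚ
open import Data.Empty using (⊥-elim)
open import Data.Fin using (Fin; zero; suc; #_; punchOut)
import Data.Fin.Properties as Finₚ
open import Data.List using (List; []; _∷_; map; filter; length)
open import Data.List.Membership.Propositional using (_∈_)
open import Data.List.Membership.Propositional.Properties using (∈-filter⁺; ∈-filter⁻)
open import Data.List.Properties using (map-∘; map-cong)
open import Data.List.Relation.Unary.Unique.Propositional using (Unique)
import Data.List.Relation.Unary.Unique.Propositional.Properties as Uniqueₚ
open import Data.Maybe using (just; nothing)
import Data.Nat as ℕ
import Data.Nat.Properties as ℕₚ
open import Data.Product using (_×_; _,_; ∃; proj₁; proj₂)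
import Data.Product.Properties as ×ₚ
open import Data.Sum using (_⊎_; inj₁; inj₂; [_,_]; [_,_]′)
open import Data.Vec using (Vec; []; _∷_; lookup; tabulate)
open import Data.Vec.Relation.Unary.Any as Any using (Any)
open import Data.Vec.Relation.Unary.Any.Properties using (lookup-index)
open import Data.Vec.Relation.Unary.AllPairs using (allPairs?)
open import Data.Vec.Relation.Unary.Unique.Propositional.Properties using (lookup-injective)
open import Data.Vec.Properties using (lookup∘tabulate; tabulate∘lookup; tabulate-cong)
import Data.Vec.Properties as Vecₚ
open import Function using (_∘_; _∋_)
open import Relation.Binary.Definitions using (DecidableEquality)
open import Relation.Binary.PropositionalEquality hiding ([_])
open import Relation.Nullary using (Dec; ¬_; yes; no; map′; _×-dec_; _⊎-dec_; _→-dec_; ¬?; contradiction)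
open import Relation.Nullary.Decidable using (from-yes)
open import Relation.Unary using (Decidable)
open import Tactic.RingSolver using (solve-∀)
open import Tactic.RingSolver.Core.AlmostCommutativeRing using (AlmostCommutativeRing; fromCommutativeRing)

pattern O = false
pattern I = true

infix 4 _≟V_ _≟M_ _≟F21_

_≟V_ : DecidableEquality V3
_≟V_ = Vecₚ.≡-dec Boolₚ._≟_

_≟M_ : DecidableEquality Mat3
_≟M_ = Vecₚ.≡-dec _≟V_

_≟F21_ : DecidableEquality F21
_≟F21_ = ×ₚ.≡-dec Finₚ._≟_ Finₚ._≟_

open import Data.List.Membership.DecPropositional _≟V_ using (_∈?_)
open import Data.List.Relation.Unary.Unique.DecPropositional _≟V_ using (unique?)

Quantifier : Set → Set₁
Quantifier A = {P : A → Set} → Decidable P → Dec (∀ a → P a)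

Exists : Set → Set₁
Exists A = {P : A → Set} → Decidable P → Dec (∃ P)

all-Bool? : Quantifier Bool
all-Bool? P? = map′ (λ (f , t) → λ { false → f ; true → t }) (λ h → h false , h true)
                    (P? false ×-dec P? true)

any-Bool? : Exists Bool
any-Bool? P? = map′ [ (false ,_) , (true ,_) ] (λ { (false , p) → inj₁ p ; (true , p) → inj₂ p })
                    (P? false ⊎-dec P? true)

all-Vec? : ∀ {A} n → Quantifier A → Quantifier (Vec A n)
all-Vec? ℕ.zero    all? P? = map′ (λ p → λ { [] → p }) (λ h → h []) (P? [])
all-Vec? (ℕ.suc n) all? P? = map′ (λ h → λ { (a ∷ v) → h a v }) (λ h a v → h (a ∷ v))
                                (all? λ a → all-Vec? n all? λ v → P? (a ∷ v))

any-Vec? : ∀ {A} n → Exists A → Exists (Vec A n)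
any-Vec? ℕ.zero    any? P? = map′ ([] ,_) (λ { ([] , p) → p }) (P? [])
any-Vec? (ℕ.suc n) any? P? = map′ (λ (a , v , p) → a ∷ v , p) (λ { (a ∷ v , p) → a , v , p })
                                (any? λ a → any-Vec? n any? λ v → P? (a ∷ v))

all-V3? : Quantifier V3
all-V3? = all-Vec? 3 all-Bool?

any-V3? : Exists V3
any-V3? = any-Vec? 3 any-Bool?

all-Mat3? : Quantifier Mat3
all-Mat3? = all-Vec? 3 all-V3?

all-F21? : Quantifier F21
all-F21? P? = map′ (λ h (i , j) → h i j) (λ h i j → h (i , j)) (Finₚ.all? λ i → Finₚ.all? λ j → P? (i , j))

any-F21? : Exists F21
any-F21? P? = map′ (λ (i , j , p) → (i , j) , p) (λ ((i , j) , p) → i , j , p)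
                   (Finₚ.any? λ i → Finₚ.any? λ j → P? (i , j))

injective⇒surjective : ∀ {n} (h : Fin n → Fin n) → (∀ {i j} → h i ≡ h j → i ≡ j) →
                       ∀ t → ∃ λ i → h i ≡ t
injective⇒surjective {ℕ.suc n} h h-inj t with Finₚ.any? (λ i → h i Finₚ.≟ t)
... | yes hit = hit
... | no miss = contradiction (Finₚ.injective⇒≤ g-injective) ℕₚ.1+n≰n
  where
  t≢h : ∀ i → t ≢ h i
  t≢h i t≡hi = miss (i , sym t≡hi)
  g : Fin (ℕ.suc n) → Fin n
  g i = punchOut (t≢h i)
  g-injective : ∀ {i j} → g i ≡ g j → i ≡ j
  g-injective {i} {j} = h-inj ∘ Finₚ.punchOut-injective (t≢h i) (t≢h j)

allV3 : List V3
allV3 = (O ∷ O ∷ O ∷ []) ∷ (O ∷ O ∷ I ∷ []) ∷ (O ∷ I ∷ O ∷ []) ∷ (O ∷ I ∷ I ∷ [])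
      ∷ (I ∷ O ∷ O ∷ []) ∷ (I ∷ O ∷ I ∷ []) ∷ (I ∷ I ∷ O ∷ []) ∷ (I ∷ I ∷ I ∷ []) ∷ []

allV3-complete : ∀ v → v ∈ allV3
allV3-complete = from-yes (all-V3? (_∈? allV3))

allV3-unique : Unique allV3
allV3-unique = from-yes (unique? allV3)

others : V3 → List V3
others c = filter (λ v → ¬? (v ≟V c)) allV3

others-length : ∀ c → length (others c) ≡ 7
others-length = from-yes (all-V3? λ c → length (others c) ℕₚ.≟ 7)

complement-card : ∀ {p} (c : V3) {P : V3 → Set p} →
                  (∀ b → P b → b ≢ c) → (∀ b → b ≢ c → P b) → HasCard P 7
complement-card c P⇒≢ ≢⇒P =
  others c , Uniqueₚ.filter⁺ ≢c? allV3-unique , others-length c ,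
  λ b → (λ Pb → ∈-filter⁺ ≢c? (allV3-complete b) (P⇒≢ b Pb))
      , (λ b∈ → ≢⇒P b (proj₂ (∈-filter⁻ ≢c? {xs = allV3} b∈)))
  where
  ≢c? : Decidable (_≢ c)
  ≢c? v = ¬? (v ≟V c)

-- Linear algebra over F₂

∷₃-cong : ∀ {A : Set} {a a′ b b′ c c′ : A} → a ≡ a′ → b ≡ b′ → c ≡ c′ →
          (Vec A 3 ∋ a ∷ b ∷ c ∷ []) ≡ a′ ∷ b′ ∷ c′ ∷ []
∷₃-cong refl refl refl = refl

+v-identityʳ : ∀ u → u +v 0v ≡ u
+v-identityʳ (x ∷ y ∷ z ∷ []) = ∷₃-cong (xor-identityʳ x) (xor-identityʳ y) (xor-identityʳ z)

+v-identityˡ : ∀ u → 0v +v u ≡ u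
+v-identityˡ (_ ∷ _ ∷ _ ∷ []) = refl

+v-self : ∀ u → u +v u ≡ 0v
+v-self (x ∷ y ∷ z ∷ []) = ∷₃-cong (xor-same x) (xor-same y) (xor-same z)

+v-cancelʳ : ∀ u v → (u +v v) +v v ≡ u
+v-cancelʳ (x ∷ y ∷ z ∷ []) (x′ ∷ y′ ∷ z′ ∷ []) = ∷₃-cong (cancel x x′) (cancel y y′) (cancel z z′)
  where
  cancel : ∀ a b → (a xor b) xor b ≡ a
  cancel a b = trans (Boolₚ.xor-assoc a b b) (trans (cong (a xor_) (xor-same b)) (xor-identityʳ a))

+v≡0⇒≡ : ∀ u v → u +v v ≡ 0v → u ≡ v
+v≡0⇒≡ u v@(_ ∷ _ ∷ _ ∷ []) eq = trans (sym (+v-cancelʳ u v)) (cong (_+v v) eq)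

+v≡ʳ⇒0v : ∀ u v → u +v v ≡ v → u ≡ 0v
+v≡ʳ⇒0v u v eq = trans (sym (+v-cancelʳ u v)) (trans (cong (_+v v) eq) (+v-self v))

infixl 25 _·M_

_·M_ : V3 → Mat3 → V3
v ·M B = tabulate λ j →
  ((lookup v zero ∧ lookup (lookup B zero) j)
   xor (lookup v (suc zero) ∧ lookup (lookup B (suc zero)) j))
   xor (lookup v (suc (suc zero)) ∧ lookup (lookup B (suc (suc zero))) j)

e₀ e₁ e₂ : V3
e₀ = true  ∷ false ∷ false ∷ []
e₁ = false ∷ true  ∷ false ∷ []
e₂ = false ∷ false ∷ true  ∷ []

scale : Bool → V3 → V3
scale false _ = 0v
scale true  v = v

·M-rows : ∀ a₀ a₁ a₂ r₀ r₁ r₂ →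
  (a₀ ∷ a₁ ∷ a₂ ∷ []) ·M (r₀ ∷ r₁ ∷ r₂ ∷ []) ≡ (scale a₀ r₀ +v scale a₁ r₁) +v scale a₂ r₂
·M-rows true  true  true  (_ ∷ _ ∷ _ ∷ []) (_ ∷ _ ∷ _ ∷ []) (_ ∷ _ ∷ _ ∷ []) = refl
·M-rows true  true  false (_ ∷ _ ∷ _ ∷ []) (_ ∷ _ ∷ _ ∷ []) (_ ∷ _ ∷ _ ∷ []) = refl
·M-rows true  false true  (_ ∷ _ ∷ _ ∷ []) (_ ∷ _ ∷ _ ∷ []) (_ ∷ _ ∷ _ ∷ []) = refl
·M-rows true  false false (_ ∷ _ ∷ _ ∷ []) (_ ∷ _ ∷ _ ∷ []) (_ ∷ _ ∷ _ ∷ []) = refl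
·M-rows false true  true  (_ ∷ _ ∷ _ ∷ []) (_ ∷ _ ∷ _ ∷ []) (_ ∷ _ ∷ _ ∷ []) = refl
·M-rows false true  false (_ ∷ _ ∷ _ ∷ []) (_ ∷ _ ∷ _ ∷ []) (_ ∷ _ ∷ _ ∷ []) = refl
·M-rows false false true  (_ ∷ _ ∷ _ ∷ []) (_ ∷ _ ∷ _ ∷ []) (_ ∷ _ ∷ _ ∷ []) = refl
·M-rows false false false (_ ∷ _ ∷ _ ∷ []) (_ ∷ _ ∷ _ ∷ []) (_ ∷ _ ∷ _ ∷ []) = refl

basis-expansion : ∀ a₀ a₁ a₂ →
  a₀ ∷ a₁ ∷ a₂ ∷ [] ≡ (scale a₀ e₀ +v scale a₁ e₁) +v scale a₂ e₂
basis-expansion true  true  true  = refl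
basis-expansion true  true  false = refl
basis-expansion true  false true  = refl
basis-expansion true  false false = refl
basis-expansion false true  true  = refl
basis-expansion false true  false = refl
basis-expansion false false true  = refl
basis-expansion false false false = refl

module _ (L : V3 → V3) (additive : ∀ u v → L (u +v v) ≡ L u +v L v) where

  additive-0v : L 0v ≡ 0v
  additive-0v = trans (additive 0v 0v) (+v-self (L 0v))

  additive-scale : ∀ b v → L (scale b v) ≡ scale b (L v)
  additive-scale false v = additive-0v
  additive-scale true  v = refl

  additive⇒·M : ∀ a → L a ≡ a ·M (L e₀ ∷ L e₁ ∷ L e₂ ∷ [])
  additive⇒·M a@(a₀ ∷ a₁ ∷ a₂ ∷ []) = begin
    L a                                                     ≡⟨ cong L (basis-expansion a₀ a₁ a₂) ⟩
    L ((scale a₀ e₀ +v scale a₁ e₁) +v scale a₂ e₂)         ≡⟨ additive _ _ ⟩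
    L (scale a₀ e₀ +v scale a₁ e₁) +v L (scale a₂ e₂)       ≡⟨ cong (_+v L (scale a₂ e₂)) (additive _ _) ⟩
    (L (scale a₀ e₀) +v L (scale a₁ e₁)) +v L (scale a₂ e₂) ≡⟨ cong₂ _+v_ (cong₂ _+v_ (additive-scale a₀ e₀) (additive-scale a₁ e₁))
                                                                          (additive-scale a₂ e₂) ⟩
    (scale a₀ (L e₀) +v scale a₁ (L e₁)) +v scale a₂ (L e₂) ≡⟨ ·M-rows a₀ a₁ a₂ (L e₀) (L e₁) (L e₂) ⟨
    a ·M (L e₀ ∷ L e₁ ∷ L e₂ ∷ [])                          ∎
    where open ≡-Reasoning

·M-identityʳ : ∀ v → v ·M I3 ≡ v
·M-identityʳ (true  ∷ true  ∷ true  ∷ []) = refl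
·M-identityʳ (true  ∷ true  ∷ false ∷ []) = refl
·M-identityʳ (true  ∷ false ∷ true  ∷ []) = refl
·M-identityʳ (true  ∷ false ∷ false ∷ []) = refl
·M-identityʳ (false ∷ true  ∷ true  ∷ []) = refl
·M-identityʳ (false ∷ true  ∷ false ∷ []) = refl
·M-identityʳ (false ∷ false ∷ true  ∷ []) = refl
·M-identityʳ (false ∷ false ∷ false ∷ []) = refl

F₂ : AlmostCommutativeRing _ _
F₂ = fromCommutativeRing xor-∧-commutativeRing λ { false → just refl ; true → nothing }

·M-*M-entry : ∀ v₀ v₁ v₂ a₀₀ a₀₁ a₀₂ a₁₀ a₁₁ a₁₂ a₂₀ a₂₁ a₂₂ b₀ b₁ b₂ →
  ((v₀ ∧ (((a₀₀ ∧ b₀) xor (a₀₁ ∧ b₁)) xor (a₀₂ ∧ b₂))) xor (v₁ ∧ (((a₁₀ ∧ b₀) xor (a₁₁ ∧ b₁)) xor (a₁₂ ∧ b₂))))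
    xor (v₂ ∧ (((a₂₀ ∧ b₀) xor (a₂₁ ∧ b₁)) xor (a₂₂ ∧ b₂)))
  ≡ ((((((v₀ ∧ a₀₀) xor (v₁ ∧ a₁₀)) xor (v₂ ∧ a₂₀)) ∧ b₀) xor ((((v₀ ∧ a₀₁) xor (v₁ ∧ a₁₁)) xor (v₂ ∧ a₂₁)) ∧ b₁))
    xor ((((v₀ ∧ a₀₂) xor (v₁ ∧ a₁₂)) xor (v₂ ∧ a₂₂)) ∧ b₂))
·M-*M-entry = solve-∀ F₂

·M-*M : ∀ v A B → v ·M (A *M B) ≡ (v ·M A) ·M B
·M-*M (v₀ ∷ v₁ ∷ v₂ ∷ [])
  ((a₀₀ ∷ a₀₁ ∷ a₀₂ ∷ []) ∷ (a₁₀ ∷ a₁₁ ∷ a₁₂ ∷ []) ∷ (a₂₀ ∷ a₂₁ ∷ a₂₂ ∷ []) ∷ [])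
  ((b₀₀ ∷ b₀₁ ∷ b₀₂ ∷ []) ∷ (b₁₀ ∷ b₁₁ ∷ b₁₂ ∷ []) ∷ (b₂₀ ∷ b₂₁ ∷ b₂₂ ∷ []) ∷ []) =
  cong₂ _∷_ (column b₀₀ b₁₀ b₂₀) (cong₂ _∷_ (column b₀₁ b₁₁ b₂₁) (cong₂ _∷_ (column b₀₂ b₁₂ b₂₂) refl))
  where column = ·M-*M-entry v₀ v₁ v₂ a₀₀ a₀₁ a₀₂ a₁₀ a₁₁ a₁₂ a₂₀ a₂₁ a₂₂

*M-identityˡ : ∀ A → I3 *M A ≡ A
*M-identityˡ A@(r₀ ∷ r₁ ∷ r₂ ∷ []) = ∷₃-cong row₀ row₁ row₂
  where
  row₀ : e₀ ·M A ≡ r₀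
  row₀ = trans (·M-rows true false false r₀ r₁ r₂) (trans (+v-identityʳ (r₀ +v 0v)) (+v-identityʳ r₀))
  row₁ : e₁ ·M A ≡ r₁
  row₁ = trans (·M-rows false true false r₀ r₁ r₂) (trans (+v-identityʳ (0v +v r₁)) (+v-identityˡ r₁))
  row₂ : e₂ ·M A ≡ r₂
  row₂ = trans (·M-rows false false true r₀ r₁ r₂) (+v-identityˡ r₂)

*M-identityʳ : ∀ A → A *M I3 ≡ A
*M-identityʳ A = trans (tabulate-cong λ i → ·M-identityʳ (lookup A i)) (tabulate∘lookup A)

*M-assoc : ∀ A B C → A *M (B *M C) ≡ (A *M B) *M C
*M-assoc A B C = tabulate-cong λ i → begin
  lookup A i ·M (B *M C)               ≡⟨ ·M-*M (lookup A i) B C ⟩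
  (lookup A i ·M B) ·M C               ≡⟨ cong (_·M C) (lookup∘tabulate (λ i → lookup A i ·M B) i) ⟨
  lookup (A *M B) i ·M C               ∎
  where open ≡-Reasoning

Mat3-rawMonoid : RawMonoid 0ℓ 0ℓ
Mat3-rawMonoid = record { Carrier = Mat3 ; _≈_ = _≡_ ; _∙_ = _*M_ ; ε = I3 }

*M-inverse-unique : ∀ {A B C} → B *M A ≡ I3 → A *M C ≡ I3 → B ≡ C
*M-inverse-unique {A} {B} {C} BA≡I AC≡I = begin
  B                ≡⟨ *M-identityʳ B ⟨
  B *M I3          ≡⟨ cong (B *M_) AC≡I ⟨
  B *M (A *M C)    ≡⟨ *M-assoc B A C ⟩
  (B *M A) *M C    ≡⟨ cong (_*M C) BA≡I ⟩
  I3 *M C          ≡⟨ *M-identityˡ C ⟩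
  C                ∎
  where open ≡-Reasoning

idempotent-invertible⇒I3 : ∀ {A} → A *M A ≡ A → InvertibleM A → A ≡ I3
idempotent-invertible⇒I3 {A} AA≡A (B , AB≡I , _) = begin
  A                ≡⟨ *M-identityʳ A ⟨
  A *M I3          ≡⟨ cong (A *M_) AB≡I ⟨
  A *M (A *M B)    ≡⟨ *M-assoc A A B ⟩
  (A *M A) *M B    ≡⟨ cong (_*M B) AA≡A ⟩
  A *M B           ≡⟨ AB≡I ⟩
  I3               ∎
  where open ≡-Reasoning

Singular : Mat3 → Set
Singular A = ∃ λ v → v ≢ 0v × v ·M A ≡ 0v

invertible⇒¬singular : ∀ {A} → InvertibleM A → ¬ Singular A
invertible⇒¬singular {A} (B , AB≡I , _) (v , v≢0 , vA≡0) = v≢0 (begin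
  v                ≡⟨ ·M-identityʳ v ⟨
  v ·M I3          ≡⟨ cong (v ·M_) AB≡I ⟨
  v ·M (A *M B)    ≡⟨ ·M-*M v A B ⟩
  v ·M A ·M B      ≡⟨ cong (_·M B) vA≡0 ⟩
  0v ·M B          ≡⟨⟩
  0v               ∎)
  where open ≡-Reasoning

-- GL(3,2) by enumeration

mat : Bool → Bool → Bool → Bool → Bool → Bool → Bool → Bool → Bool → Mat3
mat a b c d e f g h i = (a ∷ b ∷ c ∷ []) ∷ (d ∷ e ∷ f ∷ []) ∷ (g ∷ h ∷ i ∷ []) ∷ []

-- Over F₂ a nonzero determinant is 1, so the adjugate inverts every invertible matrix.
adj : Mat3 → Mat3
adj ((a ∷ b ∷ c ∷ []) ∷ (d ∷ e ∷ f ∷ []) ∷ (g ∷ h ∷ i ∷ []) ∷ []) =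
  mat (minor e f h i) (minor b c h i) (minor b c e f)
      (minor d f g i) (minor a c g i) (minor a c d f)
      (minor d e g h) (minor a b g h) (minor a b d e)
  where
  minor : Bool → Bool → Bool → Bool → Bool
  minor p q r s = (p ∧ s) xor (q ∧ r)

data Gen : Set where
  gS gT : Gen

Word : Set
Word = List Gen

S T : Mat3
S = mat O I O  I O O  O O I
T = mat O I I  O I O  I O I

gen : Gen → Mat3
gen gS = S
gen gT = T

⟦_⟧ : Word → Mat3
⟦ [] ⟧ = I3
⟦ g ∷ w ⟧ = gen g *M ⟦ w ⟧

S-invertible : InvertibleM S
S-invertible = S , refl , refl

T-invertible : InvertibleM T
T-invertible = adj T , refl , refl

conjugateProduct : Mat3 → List Mat3 → Mat3
conjugateProduct C [] = I3
conjugateProduct C (U ∷ Us) = (U *M (C *M adj U)) *M conjugateProduct C Us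

-- elementTable lists GL(3,2), and wordTable writes each element as a word in S and T.
-- For GL32 k ≢ I3, conjugatorsS k = u₁ ∷ … ∷ uₙ expresses S as the product of the
-- conjugates uᵢ (GL32 k) uᵢ⁻¹, and likewise for T: this certifies that GL(3,2) is simple.
opaque
  elementTable : Vec Mat3 168
  elementTable =
    (mat O O I  O I O  I O O) ∷ (mat O O I  O I O  I O I) ∷ (mat O O I  O I O  I I O) ∷
    (mat O O I  O I O  I I I) ∷ (mat O O I  O I I  I O O) ∷ (mat O O I  O I I  I O I) ∷
    (mat O O I  O I I  I I O) ∷ (mat O O I  O I I  I I I) ∷ (mat O O I  I O O  O I O) ∷
    (mat O O I  I O O  O I I) ∷ (mat O O I  I O O  I I O) ∷ (mat O O I  I O O  I I I) ∷
    (mat O O I  I O I  O I O) ∷ (mat O O I  I O I  O I I) ∷ (mat O O I  I O I  I I O) ∷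
    (mat O O I  I O I  I I I) ∷ (mat O O I  I I O  O I O) ∷ (mat O O I  I I O  O I I) ∷
    (mat O O I  I I O  I O O) ∷ (mat O O I  I I O  I O I) ∷ (mat O O I  I I I  O I O) ∷
    (mat O O I  I I I  O I I) ∷ (mat O O I  I I I  I O O) ∷ (mat O O I  I I I  I O I) ∷
    (mat O I O  O O I  I O O) ∷ (mat O I O  O O I  I O I) ∷ (mat O I O  O O I  I I O) ∷
    (mat O I O  O O I  I I I) ∷ (mat O I O  O I I  I O O) ∷ (mat O I O  O I I  I O I) ∷
    (mat O I O  O I I  I I O) ∷ (mat O I O  O I I  I I I) ∷ (mat O I O  I O O  O O I) ∷
    (mat O I O  I O O  O I I) ∷ (mat O I O  I O O  I O I) ∷ (mat O I O  I O O  I I I) ∷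
    (mat O I O  I O I  O O I) ∷ (mat O I O  I O I  O I I) ∷ (mat O I O  I O I  I O O) ∷
    (mat O I O  I O I  I I O) ∷ (mat O I O  I I O  O O I) ∷ (mat O I O  I I O  O I I) ∷
    (mat O I O  I I O  I O I) ∷ (mat O I O  I I O  I I I) ∷ (mat O I O  I I I  O O I) ∷
    (mat O I O  I I I  O I I) ∷ (mat O I O  I I I  I O O) ∷ (mat O I O  I I I  I I O) ∷
    (mat O I I  O O I  I O O) ∷ (mat O I I  O O I  I O I) ∷ (mat O I I  O O I  I I O) ∷
    (mat O I I  O O I  I I I) ∷ (mat O I I  O I O  I O O) ∷ (mat O I I  O I O  I O I) ∷
    (mat O I I  O I O  I I O) ∷ (mat O I I  O I O  I I I) ∷ (mat O I I  I O O  O O I) ∷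
    (mat O I I  I O O  O I O) ∷ (mat O I I  I O O  I O I) ∷ (mat O I I  I O O  I I O) ∷
    (mat O I I  I O I  O O I) ∷ (mat O I I  I O I  O I O) ∷ (mat O I I  I O I  I O O) ∷
    (mat O I I  I O I  I I I) ∷ (mat O I I  I I O  O O I) ∷ (mat O I I  I I O  O I O) ∷
    (mat O I I  I I O  I O O) ∷ (mat O I I  I I O  I I I) ∷ (mat O I I  I I I  O O I) ∷
    (mat O I I  I I I  O I O) ∷ (mat O I I  I I I  I O I) ∷ (mat O I I  I I I  I I O) ∷
    (mat I O O  O O I  O I O) ∷ (mat I O O  O O I  O I I) ∷ (mat I O O  O O I  I I O) ∷
    (mat I O O  O O I  I I I) ∷ (mat I O O  O I O  O O I) ∷ (mat I O O  O I O  O I I) ∷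
    (mat I O O  O I O  I O I) ∷ (mat I O O  O I O  I I I) ∷ (mat I O O  O I I  O O I) ∷
    (mat I O O  O I I  O I O) ∷ (mat I O O  O I I  I O I) ∷ (mat I O O  O I I  I I O) ∷
    (mat I O O  I O I  O I O) ∷ (mat I O O  I O I  O I I) ∷ (mat I O O  I O I  I I O) ∷
    (mat I O O  I O I  I I I) ∷ (mat I O O  I I O  O O I) ∷ (mat I O O  I I O  O I I) ∷
    (mat I O O  I I O  I O I) ∷ (mat I O O  I I O  I I I) ∷ (mat I O O  I I I  O O I) ∷
    (mat I O O  I I I  O I O) ∷ (mat I O O  I I I  I O I) ∷ (mat I O O  I I I  I I O) ∷
    (mat I O I  O O I  O I O) ∷ (mat I O I  O O I  O I I) ∷ (mat I O I  O O I  I I O) ∷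
    (mat I O I  O O I  I I I) ∷ (mat I O I  O I O  O O I) ∷ (mat I O I  O I O  O I I) ∷
    (mat I O I  O I O  I O O) ∷ (mat I O I  O I O  I I O) ∷ (mat I O I  O I I  O O I) ∷
    (mat I O I  O I I  O I O) ∷ (mat I O I  O I I  I O O) ∷ (mat I O I  O I I  I I I) ∷
    (mat I O I  I O O  O I O) ∷ (mat I O I  I O O  O I I) ∷ (mat I O I  I O O  I I O) ∷
    (mat I O I  I O O  I I I) ∷ (mat I O I  I I O  O O I) ∷ (mat I O I  I I O  O I O) ∷
    (mat I O I  I I O  I O O) ∷ (mat I O I  I I O  I I I) ∷ (mat I O I  I I I  O O I) ∷
    (mat I O I  I I I  O I I) ∷ (mat I O I  I I I  I O O) ∷ (mat I O I  I I I  I I O) ∷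
    (mat I I O  O O I  O I O) ∷ (mat I I O  O O I  O I I) ∷ (mat I I O  O O I  I O O) ∷
    (mat I I O  O O I  I O I) ∷ (mat I I O  O I O  O O I) ∷ (mat I I O  O I O  O I I) ∷
    (mat I I O  O I O  I O I) ∷ (mat I I O  O I O  I I I) ∷ (mat I I O  O I I  O O I) ∷
    (mat I I O  O I I  O I O) ∷ (mat I I O  O I I  I O O) ∷ (mat I I O  O I I  I I I) ∷
    (mat I I O  I O O  O O I) ∷ (mat I I O  I O O  O I I) ∷ (mat I I O  I O O  I O I) ∷
    (mat I I O  I O O  I I I) ∷ (mat I I O  I O I  O O I) ∷ (mat I I O  I O I  O I O) ∷
    (mat I I O  I O I  I O O) ∷ (mat I I O  I O I  I I I) ∷ (mat I I O  I I I  O I O) ∷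
    (mat I I O  I I I  O I I) ∷ (mat I I O  I I I  I O O) ∷ (mat I I O  I I I  I O I) ∷
    (mat I I I  O O I  O I O) ∷ (mat I I I  O O I  O I I) ∷ (mat I I I  O O I  I O O) ∷
    (mat I I I  O O I  I O I) ∷ (mat I I I  O I O  O O I) ∷ (mat I I I  O I O  O I I) ∷
    (mat I I I  O I O  I O O) ∷ (mat I I I  O I O  I I O) ∷ (mat I I I  O I I  O O I) ∷
    (mat I I I  O I I  O I O) ∷ (mat I I I  O I I  I O I) ∷ (mat I I I  O I I  I I O) ∷
    (mat I I I  I O O  O O I) ∷ (mat I I I  I O O  O I O) ∷ (mat I I I  I O O  I O I) ∷
    (mat I I I  I O O  I I O) ∷ (mat I I I  I O I  O O I) ∷ (mat I I I  I O I  O I I) ∷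
    (mat I I I  I O I  I O O) ∷ (mat I I I  I O I  I I O) ∷ (mat I I I  I I O  O I O) ∷
    (mat I I I  I I O  O I I) ∷ (mat I I I  I I O  I O O) ∷ (mat I I I  I I O  I O I) ∷ []

  wordTable : Vec Word 168
  wordTable =
    (gT ∷ gT ∷ gS ∷ gT ∷ gT ∷ gS ∷ gT ∷ gS ∷ gT ∷ []) ∷
    (gS ∷ gT ∷ gS ∷ gT ∷ gS ∷ gT ∷ gT ∷ gS ∷ gT ∷ gT ∷ gS ∷ gT ∷ []) ∷
    (gS ∷ gT ∷ gT ∷ gS ∷ gT ∷ gS ∷ gT ∷ gT ∷ []) ∷
    (gT ∷ gT ∷ gS ∷ gT ∷ gS ∷ gT ∷ gT ∷ gS ∷ gT ∷ gS ∷ gT ∷ gS ∷ gT ∷ gS ∷ []) ∷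
    (gT ∷ gT ∷ gS ∷ gT ∷ gT ∷ gS ∷ gT ∷ gT ∷ []) ∷ (gS ∷ gT ∷ gS ∷ gT ∷ gS ∷ gT ∷ gT ∷ gS ∷ []) ∷
    (gS ∷ gT ∷ gS ∷ gT ∷ gT ∷ gS ∷ gT ∷ gT ∷ gS ∷ gT ∷ gS ∷ gT ∷ gS ∷ []) ∷
    (gS ∷ gT ∷ gT ∷ gS ∷ gT ∷ gS ∷ gT ∷ gS ∷ gT ∷ []) ∷
    (gT ∷ gT ∷ gS ∷ gT ∷ gT ∷ gS ∷ gT ∷ gS ∷ gT ∷ gS ∷ []) ∷
    (gS ∷ gT ∷ gS ∷ gT ∷ gS ∷ gT ∷ gT ∷ gS ∷ gT ∷ gT ∷ gS ∷ gT ∷ gS ∷ []) ∷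
    (gS ∷ gT ∷ gT ∷ gS ∷ gT ∷ gS ∷ gT ∷ gT ∷ gS ∷ []) ∷
    (gT ∷ gT ∷ gS ∷ gT ∷ gS ∷ gT ∷ gT ∷ gS ∷ gT ∷ gS ∷ gT ∷ gS ∷ gT ∷ []) ∷
    (gS ∷ gT ∷ gS ∷ gT ∷ gS ∷ gT ∷ gS ∷ gT ∷ []) ∷ (gS ∷ gT ∷ gS ∷ gT ∷ gS ∷ gT ∷ gT ∷ []) ∷
    (gS ∷ gT ∷ gS ∷ gT ∷ gT ∷ gS ∷ gT ∷ gT ∷ gS ∷ gT ∷ gS ∷ gT ∷ []) ∷
    (gS ∷ gT ∷ gT ∷ gS ∷ gT ∷ gS ∷ gT ∷ gS ∷ gT ∷ gS ∷ []) ∷ (gT ∷ gS ∷ gT ∷ gS ∷ gT ∷ gS ∷ []) ∷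
    (gT ∷ gS ∷ gT ∷ gT ∷ gS ∷ gT ∷ gT ∷ gS ∷ gT ∷ []) ∷ (gT ∷ gS ∷ gT ∷ gS ∷ gT ∷ []) ∷
    (gT ∷ gS ∷ gT ∷ gT ∷ gS ∷ gT ∷ gT ∷ gS ∷ gT ∷ gS ∷ []) ∷ (gT ∷ gS ∷ gT ∷ gT ∷ gS ∷ []) ∷
    (gT ∷ gS ∷ gT ∷ gS ∷ gT ∷ gS ∷ gT ∷ gT ∷ gS ∷ gT ∷ []) ∷ (gT ∷ gS ∷ gT ∷ gT ∷ []) ∷
    (gT ∷ gS ∷ gT ∷ gS ∷ gT ∷ gS ∷ gT ∷ gT ∷ gS ∷ gT ∷ gS ∷ []) ∷
    (gS ∷ gT ∷ gT ∷ gS ∷ gT ∷ gT ∷ gS ∷ gT ∷ gS ∷ gT ∷ []) ∷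
    (gT ∷ gS ∷ gT ∷ gS ∷ gT ∷ gT ∷ gS ∷ gT ∷ gT ∷ gS ∷ gT ∷ []) ∷
    (gT ∷ gT ∷ gS ∷ gT ∷ gS ∷ gT ∷ gT ∷ []) ∷
    (gT ∷ gT ∷ gS ∷ gT ∷ gS ∷ gT ∷ gT ∷ gS ∷ gT ∷ gT ∷ gS ∷ gT ∷ gS ∷ []) ∷
    (gS ∷ gT ∷ gS ∷ gT ∷ gT ∷ gS ∷ gT ∷ gS ∷ []) ∷ (gS ∷ gT ∷ []) ∷
    (gT ∷ gS ∷ gT ∷ gS ∷ gT ∷ gT ∷ gS ∷ gT ∷ gS ∷ gT ∷ gS ∷ gT ∷ gT ∷ []) ∷
    (gS ∷ gT ∷ gS ∷ gT ∷ gS ∷ gT ∷ gS ∷ gT ∷ gT ∷ gS ∷ gT ∷ gT ∷ gS ∷ []) ∷ (gS ∷ []) ∷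
    (gT ∷ gT ∷ gS ∷ gT ∷ gS ∷ gT ∷ gS ∷ gT ∷ gT ∷ gS ∷ gT ∷ gS ∷ gT ∷ []) ∷
    (gT ∷ gS ∷ gT ∷ gS ∷ gT ∷ gT ∷ gS ∷ gT ∷ gS ∷ gT ∷ gS ∷ gT ∷ []) ∷
    (gT ∷ gS ∷ gT ∷ gT ∷ gS ∷ gT ∷ gS ∷ gT ∷ gT ∷ gS ∷ []) ∷ (gT ∷ gT ∷ gS ∷ gT ∷ gS ∷ []) ∷
    (gS ∷ gT ∷ gT ∷ gS ∷ gT ∷ gT ∷ gS ∷ gT ∷ gS ∷ gT ∷ gT ∷ []) ∷
    (gS ∷ gT ∷ gT ∷ gS ∷ gT ∷ gS ∷ gT ∷ gS ∷ gT ∷ gT ∷ gS ∷ gT ∷ gT ∷ gS ∷ []) ∷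
    (gT ∷ gS ∷ gT ∷ gT ∷ gS ∷ gT ∷ gS ∷ gT ∷ gS ∷ gT ∷ gS ∷ []) ∷
    (gT ∷ gS ∷ gT ∷ gS ∷ gT ∷ gT ∷ gS ∷ gT ∷ gT ∷ gS ∷ []) ∷
    (gS ∷ gT ∷ gS ∷ gT ∷ gT ∷ gS ∷ gT ∷ gS ∷ gT ∷ gS ∷ gT ∷ gT ∷ gS ∷ gT ∷ gS ∷ []) ∷
    (gT ∷ gT ∷ gS ∷ gT ∷ gS ∷ gT ∷ []) ∷ (gS ∷ gT ∷ gT ∷ gS ∷ gT ∷ gT ∷ gS ∷ gT ∷ gS ∷ []) ∷
    (gT ∷ gS ∷ gT ∷ gS ∷ gT ∷ gT ∷ gS ∷ gT ∷ gS ∷ gT ∷ gS ∷ []) ∷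
    (gS ∷ gT ∷ gS ∷ gT ∷ gT ∷ gS ∷ gT ∷ gS ∷ gT ∷ []) ∷
    (gT ∷ gT ∷ gS ∷ gT ∷ gS ∷ gT ∷ gS ∷ gT ∷ gT ∷ gS ∷ gT ∷ gS ∷ []) ∷ (gS ∷ gT ∷ gT ∷ []) ∷
    (gT ∷ gS ∷ gT ∷ gS ∷ gT ∷ gS ∷ gT ∷ gS ∷ []) ∷ (gT ∷ gS ∷ gT ∷ gS ∷ gT ∷ gT ∷ gS ∷ []) ∷
    (gT ∷ gS ∷ gT ∷ gT ∷ gS ∷ gT ∷ gT ∷ gS ∷ gT ∷ gS ∷ gT ∷ gS ∷ []) ∷
    (gT ∷ gT ∷ gS ∷ gT ∷ gS ∷ gT ∷ gS ∷ gT ∷ []) ∷ (gT ∷ gS ∷ gT ∷ gT ∷ gS ∷ gT ∷ gS ∷ []) ∷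
    (gT ∷ []) ∷ (gT ∷ gS ∷ gT ∷ gS ∷ gT ∷ gS ∷ gT ∷ gT ∷ gS ∷ gT ∷ gS ∷ gT ∷ gS ∷ []) ∷
    (gT ∷ gS ∷ gT ∷ gS ∷ gT ∷ gS ∷ gT ∷ gT ∷ gS ∷ gT ∷ gT ∷ gS ∷ []) ∷
    (gS ∷ gT ∷ gT ∷ gS ∷ gT ∷ []) ∷
    (gT ∷ gT ∷ gS ∷ gT ∷ gS ∷ gT ∷ gS ∷ gT ∷ gT ∷ gS ∷ gT ∷ gT ∷ []) ∷
    (gT ∷ gT ∷ gS ∷ gT ∷ gT ∷ gS ∷ gT ∷ gS ∷ gT ∷ gT ∷ gS ∷ []) ∷
    (gS ∷ gT ∷ gS ∷ gT ∷ gT ∷ gS ∷ gT ∷ gS ∷ gT ∷ gS ∷ gT ∷ []) ∷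
    (gT ∷ gT ∷ gS ∷ gT ∷ gS ∷ gT ∷ gT ∷ gS ∷ gT ∷ []) ∷
    (gS ∷ gT ∷ gT ∷ gS ∷ gT ∷ gT ∷ gS ∷ gT ∷ gS ∷ gT ∷ gS ∷ gT ∷ []) ∷
    (gT ∷ gT ∷ gS ∷ gT ∷ gT ∷ gS ∷ gT ∷ gS ∷ gT ∷ gS ∷ gT ∷ gS ∷ []) ∷
    (gT ∷ gS ∷ gT ∷ gS ∷ gT ∷ gT ∷ gS ∷ gT ∷ gT ∷ gS ∷ gT ∷ gS ∷ gT ∷ []) ∷
    (gS ∷ gT ∷ gS ∷ gT ∷ gT ∷ gS ∷ gT ∷ gT ∷ gS ∷ gT ∷ gS ∷ gT ∷ gT ∷ gS ∷ []) ∷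
    (gS ∷ gT ∷ gS ∷ gT ∷ gT ∷ gS ∷ gT ∷ gT ∷ []) ∷
    (gS ∷ gT ∷ gS ∷ gT ∷ gS ∷ gT ∷ gS ∷ gT ∷ gT ∷ gS ∷ []) ∷ (gS ∷ gT ∷ gS ∷ gT ∷ []) ∷
    (gT ∷ gS ∷ gT ∷ gT ∷ gS ∷ gT ∷ gS ∷ gT ∷ gS ∷ gT ∷ gT ∷ []) ∷
    (gS ∷ gT ∷ gT ∷ gS ∷ gT ∷ gS ∷ gT ∷ gS ∷ gT ∷ gT ∷ gS ∷ []) ∷ (gT ∷ gT ∷ gS ∷ gT ∷ gT ∷ []) ∷
    (gS ∷ gT ∷ gS ∷ gT ∷ gS ∷ gT ∷ gT ∷ gS ∷ gT ∷ gS ∷ []) ∷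
    (gS ∷ gT ∷ gT ∷ gS ∷ gT ∷ gT ∷ gS ∷ gT ∷ gS ∷ gT ∷ gS ∷ []) ∷
    (gT ∷ gS ∷ gT ∷ gS ∷ gT ∷ gT ∷ gS ∷ gT ∷ gT ∷ gS ∷ gT ∷ gS ∷ []) ∷
    (gT ∷ gT ∷ gS ∷ gT ∷ gS ∷ gT ∷ gT ∷ gS ∷ []) ∷
    (gT ∷ gT ∷ gS ∷ gT ∷ gS ∷ gT ∷ gT ∷ gS ∷ gT ∷ gT ∷ gS ∷ gT ∷ []) ∷ [] ∷
    (gT ∷ gS ∷ gT ∷ gS ∷ gT ∷ gT ∷ gS ∷ gT ∷ gS ∷ gT ∷ gS ∷ gT ∷ gS ∷ []) ∷
    (gS ∷ gT ∷ gS ∷ gT ∷ gS ∷ gT ∷ gT ∷ gS ∷ gT ∷ gS ∷ gT ∷ gS ∷ gT ∷ []) ∷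
    (gT ∷ gS ∷ gT ∷ gT ∷ gS ∷ gT ∷ gS ∷ gT ∷ gT ∷ []) ∷ (gT ∷ gT ∷ gS ∷ gT ∷ []) ∷
    (gS ∷ gT ∷ gT ∷ gS ∷ gT ∷ gS ∷ gT ∷ gS ∷ gT ∷ gT ∷ gS ∷ gT ∷ gT ∷ []) ∷
    (gS ∷ gT ∷ gT ∷ gS ∷ gT ∷ gT ∷ gS ∷ gT ∷ gS ∷ gT ∷ gT ∷ gS ∷ []) ∷
    (gT ∷ gS ∷ gT ∷ gT ∷ gS ∷ gT ∷ gS ∷ gT ∷ gS ∷ gT ∷ []) ∷
    (gS ∷ gT ∷ gS ∷ gT ∷ gT ∷ gS ∷ gT ∷ []) ∷ (gS ∷ gT ∷ gS ∷ []) ∷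
    (gS ∷ gT ∷ gS ∷ gT ∷ gS ∷ gT ∷ gS ∷ gT ∷ gT ∷ gS ∷ gT ∷ gS ∷ gT ∷ []) ∷
    (gS ∷ gT ∷ gS ∷ gT ∷ gS ∷ gT ∷ gS ∷ gT ∷ gT ∷ gS ∷ gT ∷ gT ∷ []) ∷
    (gT ∷ gS ∷ gT ∷ gS ∷ gT ∷ gT ∷ gS ∷ gT ∷ gT ∷ []) ∷ (gT ∷ gT ∷ gS ∷ gT ∷ gS ∷ gT ∷ gS ∷ []) ∷
    (gS ∷ gT ∷ gS ∷ gT ∷ gT ∷ gS ∷ gT ∷ gS ∷ gT ∷ gS ∷ gT ∷ gT ∷ gS ∷ gT ∷ []) ∷
    (gS ∷ gT ∷ gT ∷ gS ∷ gT ∷ gT ∷ gS ∷ gT ∷ []) ∷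
    (gT ∷ gS ∷ gT ∷ gS ∷ gT ∷ gT ∷ gS ∷ gT ∷ gS ∷ gT ∷ []) ∷
    (gT ∷ gT ∷ gS ∷ gT ∷ gS ∷ gT ∷ gS ∷ gT ∷ gT ∷ gS ∷ gT ∷ []) ∷
    (gS ∷ gT ∷ gS ∷ gT ∷ gT ∷ gS ∷ gT ∷ gS ∷ gT ∷ gS ∷ []) ∷ (gS ∷ gT ∷ gT ∷ gS ∷ []) ∷
    (gT ∷ gS ∷ gT ∷ gS ∷ gT ∷ gS ∷ gT ∷ []) ∷ (gT ∷ gS ∷ gT ∷ gS ∷ gT ∷ gT ∷ []) ∷
    (gT ∷ gS ∷ gT ∷ gT ∷ gS ∷ gT ∷ gT ∷ gS ∷ gT ∷ gS ∷ gT ∷ []) ∷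
    (gT ∷ gT ∷ gS ∷ gT ∷ gS ∷ gT ∷ gS ∷ gT ∷ gS ∷ []) ∷ (gS ∷ gT ∷ gT ∷ gS ∷ gT ∷ gS ∷ []) ∷
    (gT ∷ gT ∷ gS ∷ gT ∷ gT ∷ gS ∷ gT ∷ gS ∷ gT ∷ gT ∷ []) ∷
    (gT ∷ gT ∷ gS ∷ gT ∷ gS ∷ gT ∷ gS ∷ gT ∷ gT ∷ gS ∷ gT ∷ gT ∷ gS ∷ []) ∷
    (gS ∷ gT ∷ gS ∷ gT ∷ gT ∷ gS ∷ gT ∷ gS ∷ gT ∷ gS ∷ gT ∷ gS ∷ []) ∷
    (gT ∷ gT ∷ gS ∷ gT ∷ gS ∷ gT ∷ gT ∷ gS ∷ gT ∷ gS ∷ []) ∷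
    (gT ∷ gT ∷ gS ∷ gT ∷ gT ∷ gS ∷ gT ∷ gS ∷ gT ∷ gS ∷ gT ∷ []) ∷
    (gS ∷ gT ∷ gT ∷ gS ∷ gT ∷ gT ∷ gS ∷ gT ∷ gS ∷ gT ∷ gS ∷ gT ∷ gS ∷ []) ∷
    (gT ∷ gS ∷ gT ∷ gS ∷ gT ∷ gT ∷ gS ∷ gT ∷ gT ∷ gS ∷ gT ∷ gS ∷ gT ∷ gS ∷ []) ∷
    (gT ∷ gS ∷ gT ∷ gT ∷ gS ∷ gT ∷ []) ∷ (gT ∷ gS ∷ []) ∷
    (gT ∷ gS ∷ gT ∷ gS ∷ gT ∷ gS ∷ gT ∷ gT ∷ gS ∷ gT ∷ gS ∷ gT ∷ []) ∷
    (gT ∷ gS ∷ gT ∷ gS ∷ gT ∷ gS ∷ gT ∷ gT ∷ gS ∷ gT ∷ gT ∷ []) ∷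
    (gS ∷ gT ∷ gS ∷ gT ∷ gT ∷ gS ∷ gT ∷ gT ∷ gS ∷ gT ∷ gS ∷ gT ∷ gT ∷ []) ∷
    (gS ∷ gT ∷ gS ∷ gT ∷ gS ∷ gT ∷ gS ∷ gT ∷ gT ∷ []) ∷
    (gS ∷ gT ∷ gS ∷ gT ∷ gT ∷ gS ∷ gT ∷ gT ∷ gS ∷ []) ∷ (gS ∷ gT ∷ gS ∷ gT ∷ gS ∷ []) ∷
    (gT ∷ gS ∷ gT ∷ gT ∷ gS ∷ gT ∷ gS ∷ gT ∷ gS ∷ gT ∷ gT ∷ gS ∷ []) ∷
    (gT ∷ gT ∷ gS ∷ gT ∷ gT ∷ gS ∷ []) ∷ (gS ∷ gT ∷ gT ∷ gS ∷ gT ∷ gS ∷ gT ∷ gS ∷ gT ∷ gT ∷ []) ∷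
    (gS ∷ gT ∷ gS ∷ gT ∷ gS ∷ gT ∷ gT ∷ gS ∷ gT ∷ []) ∷ (gS ∷ gT ∷ gS ∷ gT ∷ gS ∷ gT ∷ gS ∷ []) ∷
    (gS ∷ gT ∷ gS ∷ gT ∷ gT ∷ gS ∷ gT ∷ gT ∷ gS ∷ gT ∷ []) ∷ (gS ∷ gT ∷ gS ∷ gT ∷ gS ∷ gT ∷ []) ∷
    (gS ∷ gT ∷ gS ∷ gT ∷ gT ∷ gS ∷ gT ∷ gT ∷ gS ∷ gT ∷ gS ∷ []) ∷
    (gS ∷ gT ∷ gS ∷ gT ∷ gS ∷ gT ∷ gT ∷ gS ∷ gT ∷ gT ∷ gS ∷ []) ∷
    (gT ∷ gS ∷ gT ∷ gT ∷ gS ∷ gT ∷ gS ∷ gT ∷ gS ∷ gT ∷ gT ∷ gS ∷ gT ∷ gS ∷ []) ∷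
    (gS ∷ gT ∷ gT ∷ gS ∷ gT ∷ gS ∷ gT ∷ []) ∷ (gT ∷ gT ∷ gS ∷ gT ∷ gT ∷ gS ∷ gT ∷ gS ∷ []) ∷
    (gT ∷ gS ∷ gT ∷ gT ∷ gS ∷ gT ∷ gT ∷ gS ∷ gT ∷ gS ∷ gT ∷ gT ∷ gS ∷ []) ∷
    (gT ∷ gS ∷ gT ∷ gT ∷ gS ∷ gT ∷ gT ∷ []) ∷ (gT ∷ gS ∷ gT ∷ gS ∷ gT ∷ gS ∷ gT ∷ gT ∷ gS ∷ []) ∷
    (gT ∷ gS ∷ gT ∷ []) ∷ (gS ∷ gT ∷ gS ∷ gT ∷ gS ∷ gT ∷ gT ∷ gS ∷ gT ∷ gT ∷ []) ∷
    (gS ∷ gT ∷ gT ∷ gS ∷ gT ∷ gS ∷ gT ∷ gS ∷ []) ∷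
    (gT ∷ gS ∷ gT ∷ gT ∷ gS ∷ gT ∷ gS ∷ gT ∷ gS ∷ gT ∷ gT ∷ gS ∷ gT ∷ []) ∷
    (gT ∷ gT ∷ gS ∷ gT ∷ gT ∷ gS ∷ gT ∷ []) ∷
    (gT ∷ gS ∷ gT ∷ gT ∷ gS ∷ gT ∷ gT ∷ gS ∷ gT ∷ gS ∷ gT ∷ gT ∷ []) ∷
    (gT ∷ gS ∷ gT ∷ gS ∷ gT ∷ gS ∷ gT ∷ gT ∷ []) ∷ (gT ∷ gS ∷ gT ∷ gT ∷ gS ∷ gT ∷ gT ∷ gS ∷ []) ∷
    (gT ∷ gS ∷ gT ∷ gS ∷ []) ∷ (gT ∷ gT ∷ gS ∷ gT ∷ gT ∷ gS ∷ gT ∷ gS ∷ gT ∷ gS ∷ gT ∷ gT ∷ []) ∷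
    (gT ∷ gT ∷ gS ∷ gT ∷ gS ∷ gT ∷ gT ∷ gS ∷ gT ∷ gS ∷ gT ∷ gS ∷ []) ∷
    (gT ∷ gT ∷ gS ∷ gT ∷ gT ∷ gS ∷ gT ∷ gS ∷ gT ∷ gS ∷ gT ∷ gT ∷ gS ∷ []) ∷
    (gT ∷ gT ∷ gS ∷ gT ∷ gS ∷ gT ∷ gT ∷ gS ∷ gT ∷ gS ∷ gT ∷ []) ∷
    (gS ∷ gT ∷ gS ∷ gT ∷ gT ∷ gS ∷ []) ∷
    (gS ∷ gT ∷ gS ∷ gT ∷ gS ∷ gT ∷ gS ∷ gT ∷ gT ∷ gS ∷ gT ∷ []) ∷ (gS ∷ gT ∷ gS ∷ gT ∷ gT ∷ []) ∷
    (gS ∷ gT ∷ gS ∷ gT ∷ gS ∷ gT ∷ gS ∷ gT ∷ gT ∷ gS ∷ gT ∷ gS ∷ []) ∷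
    (gS ∷ gT ∷ gS ∷ gT ∷ gS ∷ gT ∷ gT ∷ gS ∷ gT ∷ gS ∷ gT ∷ gS ∷ []) ∷
    (gT ∷ gS ∷ gT ∷ gT ∷ gS ∷ gT ∷ gS ∷ gT ∷ []) ∷
    (gS ∷ gT ∷ gT ∷ gS ∷ gT ∷ gS ∷ gT ∷ gS ∷ gT ∷ gT ∷ gS ∷ gT ∷ gS ∷ []) ∷ (gT ∷ gT ∷ []) ∷
    (gS ∷ gT ∷ gS ∷ gT ∷ gT ∷ gS ∷ gT ∷ gS ∷ gT ∷ gS ∷ gT ∷ gT ∷ []) ∷
    (gT ∷ gT ∷ gS ∷ gT ∷ gS ∷ gT ∷ gS ∷ gT ∷ gT ∷ gS ∷ []) ∷ (gS ∷ gT ∷ gT ∷ gS ∷ gT ∷ gT ∷ []) ∷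
    (gT ∷ gS ∷ gT ∷ gS ∷ gT ∷ gT ∷ gS ∷ gT ∷ gS ∷ []) ∷
    (gS ∷ gT ∷ gS ∷ gT ∷ gS ∷ gT ∷ gT ∷ gS ∷ gT ∷ gS ∷ gT ∷ []) ∷
    (gS ∷ gT ∷ gT ∷ gS ∷ gT ∷ gS ∷ gT ∷ gS ∷ gT ∷ gT ∷ gS ∷ gT ∷ []) ∷
    (gT ∷ gS ∷ gT ∷ gT ∷ gS ∷ gT ∷ gS ∷ gT ∷ gS ∷ []) ∷ (gT ∷ gT ∷ gS ∷ []) ∷
    (gS ∷ gT ∷ gS ∷ gT ∷ gT ∷ gS ∷ gT ∷ gS ∷ gT ∷ gS ∷ gT ∷ gT ∷ gS ∷ []) ∷
    (gS ∷ gT ∷ gT ∷ gS ∷ gT ∷ gT ∷ gS ∷ []) ∷ (gT ∷ gT ∷ gS ∷ gT ∷ gS ∷ gT ∷ gS ∷ gT ∷ gT ∷ []) ∷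
    (gT ∷ gS ∷ gT ∷ gS ∷ gT ∷ gT ∷ gS ∷ gT ∷ []) ∷
    (gS ∷ gT ∷ gT ∷ gS ∷ gT ∷ gT ∷ gS ∷ gT ∷ gS ∷ gT ∷ gS ∷ gT ∷ gT ∷ []) ∷
    (gT ∷ gT ∷ gS ∷ gT ∷ gS ∷ gT ∷ gT ∷ gS ∷ gT ∷ gT ∷ gS ∷ []) ∷
    (gS ∷ gT ∷ gT ∷ gS ∷ gT ∷ gT ∷ gS ∷ gT ∷ gS ∷ gT ∷ gS ∷ gT ∷ gT ∷ gS ∷ []) ∷
    (gT ∷ gT ∷ gS ∷ gT ∷ gS ∷ gT ∷ gT ∷ gS ∷ gT ∷ gT ∷ []) ∷ []

  conjugatorTableS : Vec (List (Fin 168)) 168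
  conjugatorTableS =
    (# 8 ∷ []) ∷ (# 7 ∷ # 4 ∷ []) ∷ (# 5 ∷ # 5 ∷ []) ∷ (# 23 ∷ # 1 ∷ []) ∷ (# 44 ∷ # 44 ∷ []) ∷
    (# 36 ∷ # 16 ∷ []) ∷ (# 5 ∷ # 0 ∷ []) ∷ (# 5 ∷ # 1 ∷ []) ∷ (# 147 ∷ # 1 ∷ []) ∷
    (# 13 ∷ # 1 ∷ []) ∷ (# 20 ∷ # 1 ∷ []) ∷ (# 1 ∷ # 1 ∷ []) ∷ (# 13 ∷ # 4 ∷ []) ∷
    (# 16 ∷ # 16 ∷ []) ∷ (# 1 ∷ # 0 ∷ []) ∷ (# 19 ∷ # 1 ∷ []) ∷ (# 12 ∷ # 5 ∷ []) ∷
    (# 12 ∷ # 0 ∷ []) ∷ (# 44 ∷ # 44 ∷ []) ∷ (# 2 ∷ # 0 ∷ []) ∷ (# 21 ∷ # 21 ∷ []) ∷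
    (# 123 ∷ # 5 ∷ []) ∷ (# 9 ∷ []) ∷ (# 23 ∷ # 20 ∷ []) ∷ (# 23 ∷ # 1 ∷ []) ∷ (# 20 ∷ # 5 ∷ []) ∷
    (# 13 ∷ # 5 ∷ []) ∷ (# 9 ∷ # 9 ∷ []) ∷ (# 5 ∷ # 1 ∷ []) ∷ (# 5 ∷ # 0 ∷ []) ∷
    (# 36 ∷ # 36 ∷ []) ∷ (# 44 ∷ # 8 ∷ []) ∷ (# 32 ∷ []) ∷ (# 20 ∷ # 20 ∷ []) ∷
    (# 20 ∷ # 20 ∷ []) ∷ (# 21 ∷ []) ∷ (# 30 ∷ # 30 ∷ []) ∷ (# 9 ∷ # 0 ∷ []) ∷ (# 19 ∷ # 1 ∷ []) ∷
    (# 2 ∷ # 0 ∷ []) ∷ (# 62 ∷ # 4 ∷ []) ∷ (# 146 ∷ # 4 ∷ []) ∷ (# 1 ∷ # 0 ∷ []) ∷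
    (# 12 ∷ # 4 ∷ []) ∷ (# 34 ∷ # 1 ∷ []) ∷ (# 8 ∷ # 1 ∷ []) ∷ (# 1 ∷ # 1 ∷ []) ∷
    (# 15 ∷ # 1 ∷ []) ∷ (# 23 ∷ # 5 ∷ []) ∷ (# 17 ∷ # 17 ∷ []) ∷ (# 13 ∷ # 0 ∷ []) ∷
    (# 14 ∷ # 5 ∷ []) ∷ (# 5 ∷ # 5 ∷ []) ∷ (# 13 ∷ # 0 ∷ []) ∷ (# 16 ∷ []) ∷ (# 7 ∷ # 4 ∷ []) ∷
    (# 30 ∷ # 30 ∷ []) ∷ (# 9 ∷ # 5 ∷ []) ∷ (# 17 ∷ # 1 ∷ []) ∷ (# 10 ∷ # 8 ∷ []) ∷ (# 36 ∷ []) ∷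
    (# 122 ∷ # 0 ∷ []) ∷ (# 19 ∷ # 5 ∷ []) ∷ (# 32 ∷ # 32 ∷ []) ∷ (# 38 ∷ # 0 ∷ []) ∷
    (# 17 ∷ # 17 ∷ []) ∷ (# 12 ∷ # 1 ∷ []) ∷ (# 12 ∷ # 1 ∷ []) ∷ (# 58 ∷ # 5 ∷ []) ∷
    (# 8 ∷ # 4 ∷ []) ∷ (# 11 ∷ # 1 ∷ []) ∷ (# 8 ∷ # 8 ∷ []) ∷ (# 0 ∷ []) ∷ (# 15 ∷ # 12 ∷ []) ∷
    (# 13 ∷ # 13 ∷ []) ∷ (# 9 ∷ # 1 ∷ []) ∷ [] ∷ (# 4 ∷ []) ∷ (# 12 ∷ []) ∷ (# 20 ∷ []) ∷
    (# 28 ∷ []) ∷ (# 99 ∷ # 12 ∷ []) ∷ (# 40 ∷ # 40 ∷ []) ∷ (# 40 ∷ # 12 ∷ []) ∷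
    (# 13 ∷ # 13 ∷ []) ∷ (# 72 ∷ # 5 ∷ []) ∷ (# 17 ∷ []) ∷ (# 15 ∷ # 12 ∷ []) ∷ (# 40 ∷ []) ∷
    (# 12 ∷ # 12 ∷ []) ∷ (# 13 ∷ []) ∷ (# 12 ∷ # 12 ∷ []) ∷ (# 44 ∷ []) ∷ (# 73 ∷ # 1 ∷ []) ∷
    (# 40 ∷ # 40 ∷ []) ∷ (# 8 ∷ # 5 ∷ []) ∷ (# 92 ∷ # 92 ∷ []) ∷ (# 18 ∷ # 16 ∷ []) ∷
    (# 11 ∷ # 4 ∷ []) ∷ (# 9 ∷ # 4 ∷ []) ∷ (# 84 ∷ []) ∷ (# 88 ∷ # 88 ∷ []) ∷ (# 51 ∷ # 4 ∷ []) ∷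
    (# 51 ∷ # 4 ∷ []) ∷ (# 30 ∷ []) ∷ (# 79 ∷ # 20 ∷ []) ∷ (# 32 ∷ # 20 ∷ []) ∷
    (# 32 ∷ # 32 ∷ []) ∷ (# 22 ∷ # 5 ∷ []) ∷ (# 22 ∷ # 1 ∷ []) ∷ (# 36 ∷ # 36 ∷ []) ∷
    (# 26 ∷ # 0 ∷ []) ∷ (# 28 ∷ # 28 ∷ []) ∷ (# 18 ∷ # 5 ∷ []) ∷ (# 18 ∷ # 16 ∷ []) ∷
    (# 10 ∷ # 0 ∷ []) ∷ (# 28 ∷ # 28 ∷ []) ∷ (# 18 ∷ # 1 ∷ []) ∷ (# 26 ∷ # 0 ∷ []) ∷
    (# 8 ∷ # 0 ∷ []) ∷ (# 92 ∷ # 92 ∷ []) ∷ (# 10 ∷ # 8 ∷ []) ∷ (# 16 ∷ # 4 ∷ []) ∷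
    (# 18 ∷ # 4 ∷ []) ∷ (# 88 ∷ []) ∷ (# 5 ∷ []) ∷ (# 4 ∷ # 4 ∷ []) ∷ (# 4 ∷ # 4 ∷ []) ∷
    (# 84 ∷ # 84 ∷ []) ∷ (# 82 ∷ # 16 ∷ []) ∷ (# 4 ∷ # 1 ∷ []) ∷ (# 4 ∷ # 1 ∷ []) ∷
    (# 69 ∷ # 4 ∷ []) ∷ (# 96 ∷ # 4 ∷ []) ∷ (# 22 ∷ # 4 ∷ []) ∷ (# 25 ∷ # 0 ∷ []) ∷
    (# 65 ∷ # 5 ∷ []) ∷ (# 19 ∷ # 4 ∷ []) ∷ (# 16 ∷ # 16 ∷ []) ∷ (# 16 ∷ # 0 ∷ []) ∷
    (# 23 ∷ # 4 ∷ []) ∷ (# 8 ∷ # 8 ∷ []) ∷ (# 25 ∷ # 0 ∷ []) ∷ (# 8 ∷ # 0 ∷ []) ∷ (# 1 ∷ []) ∷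
    (# 23 ∷ # 20 ∷ []) ∷ (# 21 ∷ # 21 ∷ []) ∷ (# 18 ∷ # 0 ∷ []) ∷ (# 92 ∷ []) ∷
    (# 88 ∷ # 88 ∷ []) ∷ (# 9 ∷ # 1 ∷ []) ∷ (# 18 ∷ # 0 ∷ []) ∷ (# 84 ∷ # 84 ∷ []) ∷
    (# 74 ∷ # 8 ∷ []) ∷ (# 4 ∷ # 0 ∷ []) ∷ (# 4 ∷ # 0 ∷ []) ∷ (# 45 ∷ # 1 ∷ []) ∷
    (# 9 ∷ # 9 ∷ []) ∷ (# 22 ∷ # 0 ∷ []) ∷ (# 22 ∷ # 0 ∷ []) ∷ (# 41 ∷ # 0 ∷ []) ∷
    (# 19 ∷ # 0 ∷ []) ∷ (# 21 ∷ # 0 ∷ []) ∷ (# 0 ∷ # 0 ∷ []) ∷ (# 97 ∷ # 0 ∷ []) ∷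
    (# 23 ∷ # 0 ∷ []) ∷ (# 14 ∷ # 0 ∷ []) ∷ (# 0 ∷ # 0 ∷ []) ∷ []

  conjugatorTableT : Vec (List (Fin 168)) 168
  conjugatorTableT =
    (# 100 ∷ # 2 ∷ []) ∷ (# 3 ∷ []) ∷ (# 2 ∷ # 1 ∷ []) ∷ (# 55 ∷ []) ∷ (# 101 ∷ # 2 ∷ []) ∷
    (# 20 ∷ []) ∷ (# 21 ∷ # 9 ∷ []) ∷ (# 13 ∷ # 11 ∷ []) ∷ (# 68 ∷ []) ∷ (# 5 ∷ # 2 ∷ []) ∷
    (# 12 ∷ # 10 ∷ []) ∷ (# 7 ∷ # 5 ∷ []) ∷ (# 8 ∷ # 2 ∷ []) ∷ (# 5 ∷ # 3 ∷ []) ∷ (# 30 ∷ []) ∷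
    (# 16 ∷ # 8 ∷ []) ∷ (# 11 ∷ # 1 ∷ []) ∷ (# 9 ∷ # 7 ∷ []) ∷ (# 7 ∷ # 3 ∷ []) ∷ (# 6 ∷ []) ∷
    (# 61 ∷ # 1 ∷ []) ∷ (# 40 ∷ []) ∷ (# 7 ∷ # 6 ∷ []) ∷ (# 17 ∷ []) ∷ (# 69 ∷ []) ∷
    (# 10 ∷ # 2 ∷ []) ∷ (# 4 ∷ # 2 ∷ []) ∷ (# 4 ∷ # 3 ∷ []) ∷ (# 17 ∷ # 11 ∷ []) ∷
    (# 19 ∷ # 13 ∷ []) ∷ (# 149 ∷ # 0 ∷ []) ∷ (# 12 ∷ []) ∷ (# 120 ∷ # 25 ∷ []) ∷
    (# 4 ∷ # 2 ∷ []) ∷ (# 120 ∷ # 3 ∷ []) ∷ (# 128 ∷ # 4 ∷ []) ∷ (# 125 ∷ # 1 ∷ []) ∷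
    (# 4 ∷ # 3 ∷ []) ∷ (# 11 ∷ # 3 ∷ []) ∷ (# 5 ∷ []) ∷ (# 27 ∷ []) ∷ (# 44 ∷ []) ∷ (# 29 ∷ []) ∷
    (# 37 ∷ []) ∷ (# 51 ∷ []) ∷ (# 13 ∷ # 6 ∷ []) ∷ (# 106 ∷ # 4 ∷ []) ∷ (# 22 ∷ # 4 ∷ []) ∷
    (# 6 ∷ # 0 ∷ []) ∷ (# 6 ∷ # 1 ∷ []) ∷ (# 61 ∷ []) ∷ (# 18 ∷ # 0 ∷ []) ∷ (# 102 ∷ # 0 ∷ []) ∷
    (# 53 ∷ []) ∷ (# 148 ∷ # 0 ∷ []) ∷ (# 1 ∷ []) ∷ (# 134 ∷ # 0 ∷ []) ∷ (# 12 ∷ # 3 ∷ []) ∷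
    (# 11 ∷ # 7 ∷ []) ∷ (# 13 ∷ []) ∷ (# 144 ∷ # 24 ∷ []) ∷ (# 64 ∷ []) ∷ (# 41 ∷ []) ∷
    (# 4 ∷ # 0 ∷ []) ∷ (# 50 ∷ []) ∷ (# 57 ∷ # 0 ∷ []) ∷ (# 20 ∷ # 10 ∷ []) ∷ (# 22 ∷ # 0 ∷ []) ∷
    (# 26 ∷ []) ∷ (# 14 ∷ # 0 ∷ []) ∷ (# 23 ∷ # 12 ∷ []) ∷ (# 96 ∷ # 0 ∷ []) ∷ (# 56 ∷ # 10 ∷ []) ∷
    (# 11 ∷ []) ∷ (# 5 ∷ # 2 ∷ []) ∷ (# 57 ∷ []) ∷ [] ∷ (# 11 ∷ # 10 ∷ []) ∷ (# 3 ∷ # 2 ∷ []) ∷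
    (# 1 ∷ # 0 ∷ []) ∷ (# 34 ∷ # 8 ∷ []) ∷ (# 10 ∷ []) ∷ (# 77 ∷ # 3 ∷ []) ∷ (# 8 ∷ []) ∷
    (# 69 ∷ # 3 ∷ []) ∷ (# 32 ∷ []) ∷ (# 5 ∷ # 4 ∷ []) ∷ (# 9 ∷ []) ∷ (# 27 ∷ # 25 ∷ []) ∷
    (# 6 ∷ # 0 ∷ []) ∷ (# 80 ∷ # 6 ∷ []) ∷ (# 72 ∷ # 1 ∷ []) ∷ (# 26 ∷ # 24 ∷ []) ∷ (# 56 ∷ []) ∷
    (# 6 ∷ # 2 ∷ []) ∷ (# 33 ∷ []) ∷ (# 90 ∷ # 1 ∷ []) ∷ (# 22 ∷ []) ∷ (# 23 ∷ # 1 ∷ []) ∷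
    (# 5 ∷ # 3 ∷ []) ∷ (# 77 ∷ # 0 ∷ []) ∷ (# 77 ∷ # 1 ∷ []) ∷ (# 2 ∷ []) ∷ (# 0 ∷ []) ∷
    (# 43 ∷ # 16 ∷ []) ∷ (# 18 ∷ []) ∷ (# 16 ∷ []) ∷ (# 125 ∷ # 1 ∷ []) ∷ (# 19 ∷ # 3 ∷ []) ∷
    (# 17 ∷ # 5 ∷ []) ∷ (# 5 ∷ # 1 ∷ []) ∷ (# 4 ∷ []) ∷ (# 32 ∷ # 1 ∷ []) ∷ (# 20 ∷ # 1 ∷ []) ∷
    (# 21 ∷ []) ∷ (# 19 ∷ # 5 ∷ []) ∷ (# 36 ∷ # 0 ∷ []) ∷ (# 6 ∷ # 1 ∷ []) ∷ (# 7 ∷ []) ∷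
    (# 19 ∷ # 1 ∷ []) ∷ (# 86 ∷ # 0 ∷ []) ∷ (# 14 ∷ []) ∷ (# 15 ∷ # 3 ∷ []) ∷ (# 7 ∷ # 1 ∷ []) ∷
    (# 73 ∷ # 24 ∷ []) ∷ (# 36 ∷ # 14 ∷ []) ∷ (# 78 ∷ # 1 ∷ []) ∷ (# 3 ∷ # 0 ∷ []) ∷
    (# 76 ∷ # 9 ∷ []) ∷ (# 23 ∷ []) ∷ (# 22 ∷ # 9 ∷ []) ∷ (# 17 ∷ # 13 ∷ []) ∷ (# 25 ∷ []) ∷
    (# 36 ∷ []) ∷ (# 45 ∷ []) ∷ (# 31 ∷ []) ∷ (# 24 ∷ []) ∷ (# 22 ∷ # 2 ∷ []) ∷
    (# 144 ∷ # 2 ∷ []) ∷ (# 20 ∷ # 8 ∷ []) ∷ (# 16 ∷ # 0 ∷ []) ∷ (# 7 ∷ # 1 ∷ []) ∷ (# 28 ∷ []) ∷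
    (# 15 ∷ # 8 ∷ []) ∷ (# 15 ∷ # 14 ∷ []) ∷ (# 19 ∷ []) ∷ (# 7 ∷ # 0 ∷ []) ∷ (# 65 ∷ []) ∷
    (# 72 ∷ # 48 ∷ []) ∷ (# 76 ∷ # 0 ∷ []) ∷ (# 52 ∷ []) ∷ (# 54 ∷ []) ∷ (# 80 ∷ # 8 ∷ []) ∷
    (# 15 ∷ []) ∷ (# 14 ∷ # 9 ∷ []) ∷ (# 17 ∷ # 9 ∷ []) ∷ (# 48 ∷ []) ∷ (# 65 ∷ # 2 ∷ []) ∷
    (# 14 ∷ # 2 ∷ []) ∷ (# 20 ∷ # 12 ∷ []) ∷ (# 49 ∷ []) ∷ (# 21 ∷ # 4 ∷ []) ∷ (# 14 ∷ # 6 ∷ []) ∷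
    (# 6 ∷ # 4 ∷ []) ∷ (# 60 ∷ []) ∷ (# 7 ∷ # 0 ∷ []) ∷ (# 18 ∷ # 8 ∷ []) ∷ (# 82 ∷ # 5 ∷ []) ∷ []

GL32 : Fin 168 → Mat3
GL32 k = lookup elementTable k

word : Fin 168 → Word
word k = lookup wordTable k

conjugatorsS conjugatorsT : Fin 168 → List (Fin 168)
conjugatorsS k = lookup conjugatorTableS k
conjugatorsT k = lookup conjugatorTableT k

opaque
  unfolding elementTable wordTable conjugatorTableS conjugatorTableT

  word-spec : ∀ k → ⟦ word k ⟧ ≡ GL32 k
  word-spec = from-yes (Finₚ.all? λ k → ⟦ word k ⟧ ≟M GL32 k)

  GL32-adj : ∀ k → (GL32 k *M adj (GL32 k) ≡ I3) × (adj (GL32 k) *M GL32 k ≡ I3)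
  GL32-adj = from-yes (Finₚ.all? λ k → (GL32 k *M adj (GL32 k) ≟M I3) ×-dec (adj (GL32 k) *M GL32 k ≟M I3))

  GL32-injective : ∀ i j → GL32 i ≡ GL32 j → i ≡ j
  GL32-injective = lookup-injective (from-yes (allPairs? (λ A B → ¬? (A ≟M B)) elementTable))

  -- The singularity test comes first: it settles 344 of the 512 matrices without a table search.
  GL32-complete : ∀ A → Singular A ⊎ Any (A ≡_) elementTable
  GL32-complete = from-yes (all-Mat3? λ A →
    any-V3? (λ v → ¬? (v ≟V 0v) ×-dec (v ·M A ≟V 0v)) ⊎-dec Any.any? (A ≟M_) elementTable)

  GL32-simple : ∀ k → GL32 k ≢ I3 →
    (conjugateProduct (GL32 k) (map GL32 (conjugatorsS k)) ≡ S) ×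
    (conjugateProduct (GL32 k) (map GL32 (conjugatorsT k)) ≡ T)
  GL32-simple = from-yes (Finₚ.all? λ k → ¬? (GL32 k ≟M I3) →-dec
    ((conjugateProduct (GL32 k) (map GL32 (conjugatorsS k)) ≟M S) ×-dec
     (conjugateProduct (GL32 k) (map GL32 (conjugatorsT k)) ≟M T)))

  GL32-transitive : ∀ c d → c ≢ 0v → d ≢ 0v → ∃ λ k → c ·M GL32 k ≡ d
  GL32-transitive = from-yes (all-V3? λ c → all-V3? λ d → ¬? (c ≟V 0v) →-dec (¬? (d ≟V 0v) →-dec
    Finₚ.any? λ k → c ·M GL32 k ≟V d))

GL32-invertible : ∀ k → InvertibleM (GL32 k)
GL32-invertible k = adj (GL32 k) , GL32-adj k

GL32-index : ∀ {A} → InvertibleM A → ∃ λ k → GL32 k ≡ A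
GL32-index {A} A-inv with GL32-complete A
... | inj₁ singular = ⊥-elim (invertible⇒¬singular {A} A-inv singular)
... | inj₂ A∈table  = Any.index A∈table , sym (lookup-index A∈table)

-- Matrix representations

module _ {c ℓ : Level} (G : Group c ℓ) where
  open Group G using (Carrier; _≈_; _∙_; ε; _⁻¹; rawMonoid)
  module G = Group G

  evalWord : Carrier → Carrier → Word → Carrier
  evalWord s t [] = ε
  evalWord s t (g ∷ w) = generator g ∙ evalWord s t w
    where
    generator : Gen → Carrier
    generator gS = s
    generator gT = t

  conjugates : Carrier → List Carrier → Carrier
  conjugates z [] = ε
  conjugates z (u ∷ us) = (u ∙ (z ∙ u ⁻¹)) ∙ conjugates z us

  IsMatrixRep : (Carrier → Mat3) → Set (c Level.⊔ ℓ)
  IsMatrixRep = MonoidMorphisms.IsMonoidHomomorphism rawMonoid Mat3-rawMonoid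

  module MatrixRep {h : Carrier → Mat3} (isRep : IsMatrixRep h) where
    open MonoidMorphisms.IsMonoidHomomorphism isRep public

    inverseˡ : ∀ x → h (x ⁻¹) *M h x ≡ I3
    inverseˡ x = trans (sym (homo (x ⁻¹) x)) (trans (⟦⟧-cong (G.inverseˡ x)) ε-homo)

    inverseʳ : ∀ x → h x *M h (x ⁻¹) ≡ I3
    inverseʳ x = trans (sym (homo x (x ⁻¹))) (trans (⟦⟧-cong (G.inverseʳ x)) ε-homo)

    invertible : ∀ x → InvertibleM (h x)
    invertible x = h (x ⁻¹) , inverseʳ x , inverseˡ x

    index : ∀ x → ∃ λ k → GL32 k ≡ h x
    index x = GL32-index (invertible x)

    ⁻¹-adj : ∀ x → h (x ⁻¹) ≡ adj (h x)
    ⁻¹-adj x = let k , k≡hx = index x in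
      *M-inverse-unique {h x} (inverseˡ x) (subst (λ A → A *M adj A ≡ I3) k≡hx (proj₁ (GL32-adj k)))

    evalWord-hom : ∀ {s t} → h s ≡ S → h t ≡ T → ∀ w → h (evalWord s t w) ≡ ⟦ w ⟧
    evalWord-hom hs ht []       = ε-homo
    evalWord-hom hs ht (gS ∷ w) = trans (homo _ _) (cong₂ _*M_ hs (evalWord-hom hs ht w))
    evalWord-hom hs ht (gT ∷ w) = trans (homo _ _) (cong₂ _*M_ ht (evalWord-hom hs ht w))

    evalWord-kernel : ∀ {s t} → h s ≡ I3 → h t ≡ I3 → ∀ w → h (evalWord s t w) ≡ I3
    evalWord-kernel hs ht []       = ε-homo
    evalWord-kernel hs ht (gS ∷ w) = trans (homo _ _) (cong₂ _*M_ hs (evalWord-kernel hs ht w))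
    evalWord-kernel hs ht (gT ∷ w) = trans (homo _ _) (cong₂ _*M_ ht (evalWord-kernel hs ht w))

    conjugates-hom : ∀ z us → h (conjugates z us) ≡ conjugateProduct (h z) (map h us)
    conjugates-hom z []       = ε-homo
    conjugates-hom z (u ∷ us) = begin
      h ((u ∙ (z ∙ u ⁻¹)) ∙ conjugates z us)                    ≡⟨ homo _ _ ⟩
      h (u ∙ (z ∙ u ⁻¹)) *M h (conjugates z us)                 ≡⟨ cong₂ _*M_ conjugate (conjugates-hom z us) ⟩
      (h u *M (h z *M adj (h u))) *M conjugateProduct (h z) (map h us) ∎
      where
      open ≡-Reasoning
      conjugate : h (u ∙ (z ∙ u ⁻¹)) ≡ h u *M (h z *M adj (h u))
      conjugate = trans (homo _ _) (cong (h u *M_) (trans (homo _ _) (cong (h z *M_) (⁻¹-adj u))))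

    conjugates-kernel : ∀ {z} → h z ≡ I3 → ∀ us → h (conjugates z us) ≡ I3
    conjugates-kernel hz []       = ε-homo
    conjugates-kernel {z} hz (u ∷ us) = begin
      h ((u ∙ (z ∙ u ⁻¹)) ∙ conjugates z us)      ≡⟨ homo _ _ ⟩
      h (u ∙ (z ∙ u ⁻¹)) *M h (conjugates z us)   ≡⟨ cong₂ _*M_ conjugate (conjugates-kernel hz us) ⟩
      I3 *M I3                                    ≡⟨⟩
      I3                                          ∎
      where
      open ≡-Reasoning
      conjugate : h (u ∙ (z ∙ u ⁻¹)) ≡ I3
      conjugate = begin
        h (u ∙ (z ∙ u ⁻¹))        ≡⟨ trans (homo _ _) (cong (h u *M_) (homo _ _)) ⟩
        h u *M (h z *M h (u ⁻¹))  ≡⟨ cong (λ A → h u *M (A *M h (u ⁻¹))) hz ⟩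
        h u *M (I3 *M h (u ⁻¹))   ≡⟨ cong (h u *M_) (*M-identityˡ (h (u ⁻¹))) ⟩
        h u *M h (u ⁻¹)           ≡⟨ inverseʳ u ⟩
        I3                        ∎

    module Injective (injective : ∀ {x y} → h x ≡ h y → x ≈ y) {s t : Carrier} (hs : h s ≡ S) (ht : h t ≡ T) where

      normal-form : ∀ {x k} → GL32 k ≡ h x → x ≈ evalWord s t (word k)
      normal-form {x} {k} k≡hx = injective (sym (trans (evalWord-hom hs ht (word k)) (trans (word-spec k) k≡hx)))

-- Modules on F₂³ and their derivations

module _ {c ℓ : Level} {G : Group c ℓ} (M : Module3 G) where
  open Group G using (Carrier; _≈_; _∙_; ε; _⁻¹; inverseʳ; identityˡ)
  open import Algebra.Properties.Group G using (ε⁻¹≈ε; ⁻¹-involutive)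
  open Module3 M

  act-0v : ∀ x → act 0v x ≡ 0v
  act-0v x = additive-0v (λ a → act a x) (λ a b → act-+ a b x)

  act-reflects-0v : ∀ {a} x → act a x ≡ 0v → a ≡ 0v
  act-reflects-0v {a} x ax≡0 = begin
    a                     ≡⟨ act-ε a ⟨
    act a ε               ≡⟨ act-cong a (inverseʳ x) ⟨
    act a (x ∙ x ⁻¹)      ≡⟨ act-∙ a x (x ⁻¹) ⟩
    act (act a x) (x ⁻¹)  ≡⟨ cong (λ b → act b (x ⁻¹)) ax≡0 ⟩
    act 0v (x ⁻¹)         ≡⟨ act-0v (x ⁻¹) ⟩
    0v                    ∎
    where open ≡-Reasoning

  ρ : Carrier → Mat3
  ρ x = act e₀ x ∷ act e₁ x ∷ act e₂ x ∷ []

  act-ρ : ∀ a x → act a x ≡ a ·M ρ x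
  act-ρ a x = additive⇒·M (λ a → act a x) (λ a b → act-+ a b x) a

  ρ-isRep : IsMatrixRep G ρ
  ρ-isRep = record
    { isMagmaHomomorphism = record
      { isRelHomomorphism = record { cong = λ x≈y → ∷₃-cong (act-cong e₀ x≈y) (act-cong e₁ x≈y) (act-cong e₂ x≈y) }
      ; homo = λ x y → ∷₃-cong (row e₀ x y) (row e₁ x y) (row e₂ x y)
      }
    ; ε-homo = ∷₃-cong (act-ε e₀) (act-ε e₁) (act-ε e₂)
    }
    where
    row : ∀ e x y → act e (x ∙ y) ≡ act e x ·M ρ y
    row e x y = trans (act-∙ e x y) (act-ρ (act e x) y)

  irreducible⇒nontrivial : Irreducible M → ¬ (∀ x → ρ x ≡ I3)
  irreducible⇒nontrivial irr trivial with irr Line (inj₁ refl) closed invariant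
    where
    Line : V3 → Set
    Line b = b ≡ 0v ⊎ b ≡ e₀
    closed : ∀ a b → Line a → Line b → Line (a +v b)
    closed _ _ (inj₁ refl) (inj₁ refl) = inj₁ refl
    closed _ _ (inj₁ refl) (inj₂ refl) = inj₂ refl
    closed _ _ (inj₂ refl) (inj₁ refl) = inj₂ refl
    closed _ _ (inj₂ refl) (inj₂ refl) = inj₁ refl
    invariant : ∀ a x → Line a → Line (act a x)
    invariant a x = subst Line (sym (trans (act-ρ a x) (trans (cong (a ·M_) (trivial x)) (·M-identityʳ a))))
  ... | inj₁ only-0v    = contradiction (only-0v e₀ (inj₂ refl)) λ ()
  ... | inj₂ everything = [ (λ ()) , (λ ()) ]′ (everything e₁)

  derivation-ε : ∀ {f} → IsDerivation M f → f ε ≡ 0v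
  derivation-ε {f} (f-cong , f-∙) = begin
    f ε                       ≡⟨ f-cong (identityˡ ε) ⟨
    f (ε ∙ ε)                 ≡⟨ f-∙ ε ε ⟩
    f ε +v act (f ε) (ε ⁻¹)   ≡⟨ cong (f ε +v_) (trans (act-cong (f ε) ε⁻¹≈ε) (act-ε (f ε))) ⟩
    f ε +v f ε                ≡⟨ +v-self (f ε) ⟩
    0v                        ∎
    where open ≡-Reasoning

  module InnerImage (transitive : ∀ a b → a ≢ 0v → b ≢ 0v → ∃ λ x → act a x ≡ b)
                    {f} {c} (inner : IsInnerBy M f c) (c≢0 : c ≢ 0v) where

    image⇒≢ : ∀ b → InImage M f b → b ≢ c
    image⇒≢ b (x , fx≡b) b≡c =
      c≢0 (act-reflects-0v (x ⁻¹) (+v≡ʳ⇒0v _ c (trans (sym (inner x)) (trans fx≡b b≡c))))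

    ≢⇒image : ∀ b → b ≢ c → InImage M f b
    ≢⇒image b b≢c = let y , cy≡b+c = transitive c (b +v c) c≢0 (b≢c ∘ +v≡0⇒≡ b c) in y ⁻¹ , (begin
      f (y ⁻¹)                   ≡⟨ inner (y ⁻¹) ⟩
      act c (y ⁻¹ ⁻¹) +v c       ≡⟨ cong (_+v c) (trans (act-cong c (⁻¹-involutive y)) cy≡b+c) ⟩
      (b +v c) +v c              ≡⟨ +v-cancelʳ b c ⟩
      b                          ∎)
      where open ≡-Reasoning

  inner-derivation : (∀ a b → a ≢ 0v → b ≢ 0v → ∃ λ x → act a x ≡ b) →
    ∀ {f} → IsInner M f → ¬ (∀ x → f x ≡ 0v) →
    HasCard (InImage M f) 7 × InImage M f 0v × (∀ a → ¬ InImage M f a → IsInnerBy M f a)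
  inner-derivation transitive {f} (c , inner) f≢0 =
    complement-card c image⇒≢ ≢⇒image , ≢⇒image 0v (c≢0 ∘ sym) , missing⇒inner
    where
    c≢0 : c ≢ 0v
    c≢0 refl = f≢0 λ x → trans (inner x) (cong (_+v 0v) (act-0v (x ⁻¹)))
    open InnerImage transitive inner c≢0
    missing⇒inner : ∀ a → ¬ InImage M f a → IsInnerBy M f a
    missing⇒inner a a∉Im with a ≟V c
    ... | yes refl = inner
    ... | no a≢c   = ⊥-elim (a∉Im (≢⇒image a a≢c))

  kernel≅F21 : ∀ {h f} → IsMatrixRep G h → (∀ {x y} → h x ≡ h y → x ≈ y) → (κ : F21 → Mat3) →
    (∀ t u → κ t *M κ u ≡ κ (t ·F21 u)) → (∀ t u → κ t ≡ κ u → t ≡ u) →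
    (∀ x → f x ≡ 0v → ∃ λ t → κ t ≡ h x) → (∀ t → ∃ λ x → f x ≡ 0v × h x ≡ κ t) → KerIsoF21 M f
  kernel≅F21 {h} {f} isRep injective κ κ-hom κ-injective kernel⊆κ κ⊆kernel =
    ψ , ψ-cong , ψ-hom , ψ-injective , ψ-surjective
    where
    open MonoidMorphisms.IsMonoidHomomorphism isRep

    label : Mat3 → F21
    label A with any-F21? (λ t → κ t ≟M A)
    ... | yes (t , _) = t
    ... | no _        = zero , zero  -- junk: not reached on the kernel

    label-spec : ∀ {A} → (∃ λ t → κ t ≡ A) → κ (label A) ≡ A
    label-spec {A} hit with any-F21? (λ t → κ t ≟M A)
    ... | yes (t , κt≡A) = κt≡A
    ... | no miss        = ⊥-elim (miss hit)

    label-κ : ∀ t → label (κ t) ≡ t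
    label-κ t = κ-injective _ _ (label-spec (t , refl))

    ψ : Carrier → F21
    ψ x = label (h x)

    ψ-spec : ∀ {x} → f x ≡ 0v → κ (ψ x) ≡ h x
    ψ-spec {x} fx≡0 = label-spec (kernel⊆κ x fx≡0)

    ψ-cong : ∀ {x y} → f x ≡ 0v → f y ≡ 0v → x ≈ y → ψ x ≡ ψ y
    ψ-cong _ _ x≈y = cong label (⟦⟧-cong x≈y)

    ψ-hom : ∀ x y → f x ≡ 0v → f y ≡ 0v → ψ (x ∙ y) ≡ ψ x ·F21 ψ y
    ψ-hom x y fx≡0 fy≡0 = trans (cong label h-xy) (label-κ (ψ x ·F21 ψ y))
      where
      h-xy : h (x ∙ y) ≡ κ (ψ x ·F21 ψ y)
      h-xy = trans (homo x y) (trans (sym (cong₂ _*M_ (ψ-spec fx≡0) (ψ-spec fy≡0))) (κ-hom (ψ x) (ψ y)))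

    ψ-injective : ∀ {x y} → f x ≡ 0v → f y ≡ 0v → ψ x ≡ ψ y → x ≈ y
    ψ-injective fx≡0 fy≡0 ψx≡ψy = injective (trans (sym (ψ-spec fx≡0)) (trans (cong κ ψx≡ψy) (ψ-spec fy≡0)))

    ψ-surjective : ∀ t → ∃ λ x → (f x ≡ 0v) × (ψ x ≡ t)
    ψ-surjective t = let x , fx≡0 , hx≡κt = κ⊆kernel t in x , fx≡0 , trans (cong label hx≡κt) (label-κ t)

-- Derivations of GL(3,2) into its natural module

cocycle : V3 → V3 → Word → V3
cocycle a b [] = 0v
cocycle a b (g ∷ w) = value g +v cocycle a b w ·M adj (gen g)
  where
  value : Gen → V3
  value gS = a
  value gT = b

cocycleAt : V3 → V3 → Fin 168 → V3
cocycleAt a b k = cocycle a b (word k)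

RelatorsHold : V3 → V3 → Set
RelatorsHold a b = cocycle a b (gS ∷ gS ∷ []) ≡ 0v × cocycle a b (gT ∷ gT ∷ gT ∷ []) ≡ 0v

entry : Vec (Vec (Fin 168) 3) 7 → F21 → Fin 168
entry table (i , j) = lookup (lookup table i) j

record OuterCertificate (a b : V3) (kernel : F21 → Fin 168) : Set where
  field
    kernel-hom       : ∀ t u → GL32 (kernel t) *M GL32 (kernel u) ≡ GL32 (kernel (t ·F21 u))
    kernel-injective : ∀ t u → kernel t ≡ kernel u → t ≡ u
    kernel-complete  : ∀ k → cocycleAt a b k ≡ 0v → ∃ λ t → kernel t ≡ k
    kernel-sound     : ∀ t → cocycleAt a b (kernel t) ≡ 0v
    onto             : ∀ v → ∃ λ k → cocycleAt a b k ≡ v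

outer? : ∀ a b kernel → Dec (OuterCertificate a b kernel)
outer? a b kernel = map′ (λ (h , i , c , s , o) → record
    { kernel-hom = h ; kernel-injective = i ; kernel-complete = c ; kernel-sound = s ; onto = o })
  (λ cert → let open OuterCertificate cert in kernel-hom , kernel-injective , kernel-complete , kernel-sound , onto)
  ((all-F21? λ t → all-F21? λ u → GL32 (kernel t) *M GL32 (kernel u) ≟M GL32 (kernel (t ·F21 u))) ×-dec
   (all-F21? λ t → all-F21? λ u → (kernel t Finₚ.≟ kernel u) →-dec (t ≟F21 u)) ×-dec
   (Finₚ.all? λ k → (cocycleAt a b k ≟V 0v) →-dec any-F21? λ t → kernel t Finₚ.≟ k) ×-dec
   (all-F21? λ t → cocycleAt a b (kernel t) ≟V 0v) ×-dec
   (all-V3? λ v → Finₚ.any? λ k → cocycleAt a b k ≟V v))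

data Verdict : Set where
  violates-relator : Verdict
  inner-by         : V3 → Verdict
  outer            : Vec (Vec (Fin 168) 3) 7 → Verdict

Valid : V3 → V3 → Verdict → Set
Valid a b violates-relator = ¬ RelatorsHold a b
Valid a b (inner-by c)     = ∀ k → cocycleAt a b k ≡ c ·M adj (GL32 k) +v c
Valid a b (outer table)    = OuterCertificate a b (entry table)

valid? : ∀ a b v → Dec (Valid a b v)
valid? a b violates-relator =
  ¬? ((cocycle a b (gS ∷ gS ∷ []) ≟V 0v) ×-dec (cocycle a b (gT ∷ gT ∷ gT ∷ []) ≟V 0v))
valid? a b (inner-by c)     = Finₚ.all? λ k → cocycleAt a b k ≟V c ·M adj (GL32 k) +v c
valid? a b (outer table)    = outer? a b (entry table)

-- A derivation is determined by its values a, b at S and T, and the relators S² = T³ = 1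
-- leave sixteen pairs (a, b). Eight are inner; for the other eight the table lists the
-- kernel, with entry (i , j) equal to rⁱ sʲ where r has order 7, s has order 3, s r s⁻¹ = r².
classify : V3 → V3 → Verdict
classify (O ∷ O ∷ O ∷ []) (O ∷ O ∷ O ∷ []) = inner-by (O ∷ O ∷ O ∷ [])
classify (O ∷ O ∷ O ∷ []) (O ∷ I ∷ I ∷ []) = inner-by (I ∷ I ∷ O ∷ [])
classify (O ∷ O ∷ O ∷ []) (I ∷ O ∷ O ∷ []) = inner-by (I ∷ I ∷ I ∷ [])
classify (O ∷ O ∷ O ∷ []) (I ∷ I ∷ I ∷ []) = inner-by (O ∷ O ∷ I ∷ [])
classify (I ∷ I ∷ O ∷ []) (O ∷ O ∷ O ∷ []) = inner-by (O ∷ I ∷ O ∷ [])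
classify (I ∷ I ∷ O ∷ []) (O ∷ I ∷ I ∷ []) = inner-by (I ∷ O ∷ O ∷ [])
classify (I ∷ I ∷ O ∷ []) (I ∷ O ∷ O ∷ []) = inner-by (I ∷ O ∷ I ∷ [])
classify (I ∷ I ∷ O ∷ []) (I ∷ I ∷ I ∷ []) = inner-by (O ∷ I ∷ I ∷ [])
classify (O ∷ O ∷ I ∷ []) (O ∷ O ∷ O ∷ []) = outer
  ((# 76 ∷ # 5 ∷ # 114 ∷ []) ∷ (# 15 ∷ # 111 ∷ # 75 ∷ []) ∷ (# 165 ∷ # 151 ∷ # 153 ∷ []) ∷ (# 57 ∷ # 121 ∷ # 39 ∷ []) ∷
   (# 25 ∷ # 62 ∷ # 132 ∷ []) ∷ (# 119 ∷ # 93 ∷ # 21 ∷ []) ∷ (# 130 ∷ # 40 ∷ # 53 ∷ []) ∷ [])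
classify (O ∷ O ∷ I ∷ []) (O ∷ I ∷ I ∷ []) = outer
  ((# 76 ∷ # 21 ∷ # 62 ∷ []) ∷ (# 10 ∷ # 50 ∷ # 83 ∷ []) ∷ (# 123 ∷ # 129 ∷ # 135 ∷ []) ∷ (# 115 ∷ # 42 ∷ # 164 ∷ []) ∷
   (# 161 ∷ # 102 ∷ # 44 ∷ []) ∷ (# 69 ∷ # 87 ∷ # 1 ∷ []) ∷ (# 28 ∷ # 156 ∷ # 97 ∷ []) ∷ [])
classify (O ∷ O ∷ I ∷ []) (I ∷ O ∷ O ∷ []) = outer
  ((# 76 ∷ # 14 ∷ # 142 ∷ []) ∷ (# 17 ∷ # 133 ∷ # 73 ∷ []) ∷ (# 70 ∷ # 55 ∷ # 61 ∷ []) ∷ (# 108 ∷ # 147 ∷ # 43 ∷ []) ∷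
   (# 26 ∷ # 114 ∷ # 156 ∷ []) ∷ (# 131 ∷ # 81 ∷ # 5 ∷ []) ∷ (# 162 ∷ # 44 ∷ # 103 ∷ []) ∷ [])
classify (O ∷ O ∷ I ∷ []) (I ∷ I ∷ I ∷ []) = outer
  ((# 76 ∷ # 19 ∷ # 118 ∷ []) ∷ (# 9 ∷ # 97 ∷ # 85 ∷ []) ∷ (# 51 ∷ # 61 ∷ # 59 ∷ []) ∷ (# 155 ∷ # 31 ∷ # 129 ∷ []) ∷
   (# 143 ∷ # 150 ∷ # 40 ∷ []) ∷ (# 113 ∷ # 95 ∷ # 3 ∷ []) ∷ (# 38 ∷ # 132 ∷ # 147 ∷ []) ∷ [])
classify (I ∷ I ∷ I ∷ []) (O ∷ O ∷ O ∷ []) = outer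
  ((# 76 ∷ # 8 ∷ # 24 ∷ []) ∷ (# 7 ∷ # 43 ∷ # 87 ∷ []) ∷ (# 158 ∷ # 145 ∷ # 151 ∷ []) ∷ (# 98 ∷ # 53 ∷ # 133 ∷ []) ∷
   (# 140 ∷ # 118 ∷ # 68 ∷ []) ∷ (# 37 ∷ # 83 ∷ # 19 ∷ []) ∷ (# 66 ∷ # 136 ∷ # 105 ∷ []) ∷ [])
classify (I ∷ I ∷ I ∷ []) (O ∷ I ∷ I ∷ []) = outer
  ((# 76 ∷ # 1 ∷ # 102 ∷ []) ∷ (# 16 ∷ # 105 ∷ # 93 ∷ []) ∷ (# 47 ∷ # 41 ∷ # 31 ∷ []) ∷ (# 139 ∷ # 59 ∷ # 145 ∷ []) ∷
   (# 154 ∷ # 142 ∷ # 64 ∷ []) ∷ (# 109 ∷ # 75 ∷ # 14 ∷ []) ∷ (# 48 ∷ # 160 ∷ # 134 ∷ []) ∷ [])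
classify (I ∷ I ∷ I ∷ []) (I ∷ O ∷ O ∷ []) = outer
  ((# 76 ∷ # 23 ∷ # 106 ∷ []) ∷ (# 6 ∷ # 103 ∷ # 95 ∷ []) ∷ (# 137 ∷ # 135 ∷ # 121 ∷ []) ∷ (# 45 ∷ # 153 ∷ # 55 ∷ []) ∷
   (# 58 ∷ # 24 ∷ # 160 ∷ []) ∷ (# 99 ∷ # 85 ∷ # 8 ∷ []) ∷ (# 166 ∷ # 64 ∷ # 42 ∷ []) ∷ [])
classify (I ∷ I ∷ I ∷ []) (I ∷ I ∷ I ∷ []) = outer
  ((# 76 ∷ # 3 ∷ # 150 ∷ []) ∷ (# 12 ∷ # 164 ∷ # 81 ∷ []) ∷ (# 29 ∷ # 39 ∷ # 41 ∷ []) ∷ (# 117 ∷ # 134 ∷ # 50 ∷ []) ∷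
   (# 67 ∷ # 106 ∷ # 136 ∷ []) ∷ (# 159 ∷ # 73 ∷ # 23 ∷ []) ∷ (# 122 ∷ # 68 ∷ # 111 ∷ []) ∷ [])
classify _ _ = violates-relator

classify-valid? : ∀ a b → Dec (Valid a b (classify a b))
classify-valid? a b = valid? a b (classify a b)

-- Checked one row at a time: a single decision over all 64 pairs exhausts memory.
opaque
  unfolding elementTable wordTable

  classify-valid : ∀ a b → Valid a b (classify a b)
  classify-valid (O ∷ O ∷ O ∷ []) = from-yes (all-V3? (classify-valid? (O ∷ O ∷ O ∷ [])))
  classify-valid (O ∷ O ∷ I ∷ []) = from-yes (all-V3? (classify-valid? (O ∷ O ∷ I ∷ [])))
  classify-valid (O ∷ I ∷ O ∷ []) = from-yes (all-V3? (classify-valid? (O ∷ I ∷ O ∷ [])))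
  classify-valid (O ∷ I ∷ I ∷ []) = from-yes (all-V3? (classify-valid? (O ∷ I ∷ I ∷ [])))
  classify-valid (I ∷ O ∷ O ∷ []) = from-yes (all-V3? (classify-valid? (I ∷ O ∷ O ∷ [])))
  classify-valid (I ∷ O ∷ I ∷ []) = from-yes (all-V3? (classify-valid? (I ∷ O ∷ I ∷ [])))
  classify-valid (I ∷ I ∷ O ∷ []) = from-yes (all-V3? (classify-valid? (I ∷ I ∷ O ∷ [])))
  classify-valid (I ∷ I ∷ I ∷ []) = from-yes (all-V3? (classify-valid? (I ∷ I ∷ I ∷ [])))

-- The module is natural

module _ {c ℓ : Level} {G : Group c ℓ} (iso : IsoGL32 G) (M : Module3 G) (irr : Irreducible M) where
  open Group G using (Carrier; _≈_; _∙_; ε; _⁻¹; identityˡ)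
  open import Algebra.Properties.Group G using (x∙y⁻¹≈ε⇒x≈y)
  open IsoGL32 iso
  open Module3 M

  φ-isRep : IsMatrixRep G φ
  φ-isRep = record
    { isMagmaHomomorphism = record { isRelHomomorphism = record { cong = φ-cong } ; homo = φ-hom }
    ; ε-homo = idempotent-invertible⇒I3 {φ ε} (trans (sym (φ-hom ε ε)) (φ-cong (identityˡ ε))) (φ-inv ε)
    }

  module φ-Rep = MatrixRep G φ-isRep
  module ρ-Rep = MatrixRep G (ρ-isRep M)

  φ-preimage : ∀ k → ∃ λ x → φ x ≡ GL32 k
  φ-preimage k = φ-surj (GL32 k) (GL32-invertible k)

  -- ker ρ is normal: the products of conjugates of z that φ sends to S and T lie in it.
  nontrivial-kernel⇒trivial : ∀ {z k} → ρ M z ≡ I3 → GL32 k ≡ φ z → GL32 k ≢ I3 →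
                              ∀ x → ρ M x ≡ I3
  nontrivial-kernel⇒trivial {z} {k} ρz≡I k≡φz k≢I x =
    trans (ρ-Rep.⟦⟧-cong (normal-form (proj₂ (φ-Rep.index x))))
          (ρ-Rep.evalWord-kernel (ρ-Rep.conjugates-kernel ρz≡I (preimages (conjugatorsS k)))
                                 (ρ-Rep.conjugates-kernel ρz≡I (preimages (conjugatorsT k)))
                                 (word (proj₁ (φ-Rep.index x))))
    where
    preimages : List (Fin 168) → List Carrier
    preimages = map (proj₁ ∘ φ-preimage)
    φ-conjugates : ∀ ks → φ (conjugates G z (preimages ks)) ≡ conjugateProduct (GL32 k) (map GL32 ks)
    φ-conjugates ks = trans (φ-Rep.conjugates-hom z (preimages ks))
      (cong₂ conjugateProduct (sym k≡φz) (trans (sym (map-∘ ks)) (map-cong (proj₂ ∘ φ-preimage) ks)))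
    open φ-Rep.Injective φ-inj (trans (φ-conjugates (conjugatorsS k)) (proj₁ (GL32-simple k k≢I)))
                           (trans (φ-conjugates (conjugatorsT k)) (proj₂ (GL32-simple k k≢I)))

  ρ-faithful : ∀ {z} → ρ M z ≡ I3 → z ≈ ε
  ρ-faithful {z} ρz≡I = trivial-kernel (φ-Rep.index z)
    where
    trivial-kernel : (∃ λ k → GL32 k ≡ φ z) → z ≈ ε
    trivial-kernel (k , k≡φz) with GL32 k ≟M I3
    ... | yes k≡I = φ-inj (trans (sym k≡φz) (trans k≡I (sym φ-Rep.ε-homo)))
    ... | no  k≢I = ⊥-elim (irreducible⇒nontrivial M irr (nontrivial-kernel⇒trivial ρz≡I k≡φz k≢I))

  ρ-injective : ∀ {x y} → ρ M x ≡ ρ M y → x ≈ y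
  ρ-injective {x} {y} ρx≡ρy = x∙y⁻¹≈ε⇒x≈y x y (ρ-faithful (begin
    ρ M (x ∙ y ⁻¹)          ≡⟨ ρ-Rep.homo x (y ⁻¹) ⟩
    ρ M x *M ρ M (y ⁻¹)     ≡⟨ cong (_*M ρ M (y ⁻¹)) ρx≡ρy ⟩
    ρ M y *M ρ M (y ⁻¹)     ≡⟨ ρ-Rep.inverseʳ y ⟩
    I3                      ∎))
    where open ≡-Reasoning

  -- Opaque, so that σ and τ below never unfold into the pigeonhole search during conversion checks.
  opaque
    ρ-onto : ∀ k → ∃ λ x → GL32 k ≡ ρ M x
    ρ-onto k = pre j , trans (cong GL32 (sym relabel-j≡k)) (proj₂ (ρ-Rep.index (pre j)))
      where
      pre : Fin 168 → Carrier
      pre j = proj₁ (φ-preimage j)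
      relabel : Fin 168 → Fin 168
      relabel j = proj₁ (ρ-Rep.index (pre j))
      relabel-injective : ∀ {i j} → relabel i ≡ relabel j → i ≡ j
      relabel-injective {i} {j} eq = GL32-injective i j (begin
        GL32 i        ≡⟨ proj₂ (φ-preimage i) ⟨
        φ (pre i)     ≡⟨ φ-cong (ρ-injective (trans (sym (proj₂ (ρ-Rep.index (pre i))))
                                               (trans (cong GL32 eq) (proj₂ (ρ-Rep.index (pre j)))))) ⟩
        φ (pre j)     ≡⟨ proj₂ (φ-preimage j) ⟩
        GL32 j        ∎)
        where open ≡-Reasoning
      j : Fin 168
      j = proj₁ (injective⇒surjective relabel relabel-injective k)
      relabel-j≡k : relabel j ≡ k
      relabel-j≡k = proj₂ (injective⇒surjective relabel relabel-injective k)

  ρ-onto-invertible : ∀ A → InvertibleM A → ∃ λ x → ρ M x ≡ A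
  ρ-onto-invertible A A-inv =
    let k , k≡A  = GL32-index A-inv
        x , k≡ρx = ρ-onto k
    in x , trans (sym k≡ρx) k≡A

  σ τ : Carrier
  σ = proj₁ (ρ-onto-invertible S S-invertible)
  τ = proj₁ (ρ-onto-invertible T T-invertible)

  ρσ≡S : ρ M σ ≡ S
  ρσ≡S = proj₂ (ρ-onto-invertible S S-invertible)

  ρτ≡T : ρ M τ ≡ T
  ρτ≡T = proj₂ (ρ-onto-invertible T T-invertible)

  open ρ-Rep.Injective ρ-injective ρσ≡S ρτ≡T

  act-transitive : ∀ a b → a ≢ 0v → b ≢ 0v → ∃ λ x → act a x ≡ b
  act-transitive a b a≢0 b≢0 =
    let k , ak≡b = GL32-transitive a b a≢0 b≢0
        x , k≡ρx = ρ-onto k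
    in x , trans (act-ρ M a x) (trans (cong (a ·M_) (sym k≡ρx)) ak≡b)

  module _ {f : Carrier → V3} (f-der : IsDerivation M f) where
    private
      f-cong : ∀ {x y} → x ≈ y → f x ≡ f y
      f-cong = proj₁ f-der

    f-step : ∀ s w → f (s ∙ evalWord G σ τ w) ≡ f s +v f (evalWord G σ τ w) ·M adj (ρ M s)
    f-step s w = trans (proj₂ f-der s (evalWord G σ τ w)) (cong (f s +v_) (begin
      act (f (evalWord G σ τ w)) (s ⁻¹)    ≡⟨ act-ρ M _ (s ⁻¹) ⟩
      f (evalWord G σ τ w) ·M ρ M (s ⁻¹)   ≡⟨ cong (f (evalWord G σ τ w) ·M_) (ρ-Rep.⁻¹-adj s) ⟩
      f (evalWord G σ τ w) ·M adj (ρ M s)  ∎))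
      where open ≡-Reasoning

    f-evalWord : ∀ w → f (evalWord G σ τ w) ≡ cocycle (f σ) (f τ) w
    f-evalWord []       = derivation-ε M f-der
    f-evalWord (gS ∷ w) = trans (f-step σ w) (cong₂ (λ v A → f σ +v v ·M adj A) (f-evalWord w) ρσ≡S)
    f-evalWord (gT ∷ w) = trans (f-step τ w) (cong₂ (λ v A → f τ +v v ·M adj A) (f-evalWord w) ρτ≡T)

    f-at : ∀ {x k} → GL32 k ≡ ρ M x → f x ≡ cocycleAt (f σ) (f τ) k
    f-at {k = k} k≡ρx = trans (f-cong (normal-form k≡ρx)) (f-evalWord (word k))

    relators-hold : RelatorsHold (f σ) (f τ)
    relators-hold = relator (gS ∷ gS ∷ []) refl , relator (gT ∷ gT ∷ gT ∷ []) refl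
      where
      relator : ∀ w → ⟦ w ⟧ ≡ I3 → cocycle (f σ) (f τ) w ≡ 0v
      relator w w≡I = begin
        cocycle (f σ) (f τ) w   ≡⟨ f-evalWord w ⟨
        f (evalWord G σ τ w)    ≡⟨ f-cong (ρ-injective (trans (ρ-Rep.evalWord-hom ρσ≡S ρτ≡T w)
                                                          (trans w≡I (sym ρ-Rep.ε-homo)))) ⟩
        f ε                     ≡⟨ derivation-ε M f-der ⟩
        0v                      ∎
        where open ≡-Reasoning

    inner-by-verdict : ∀ {c} → Valid (f σ) (f τ) (inner-by c) → IsInnerBy M f c
    inner-by-verdict {c} valid x = begin
      f x                       ≡⟨ f-at k≡ρx ⟩
      cocycleAt (f σ) (f τ) k   ≡⟨ valid k ⟩
      c ·M adj (GL32 k) +v c    ≡⟨ cong (λ A → c ·M adj A +v c) k≡ρx ⟩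
      c ·M adj (ρ M x) +v c     ≡⟨ cong (λ A → c ·M A +v c) (ρ-Rep.⁻¹-adj x) ⟨
      c ·M ρ M (x ⁻¹) +v c      ≡⟨ cong (_+v c) (act-ρ M c (x ⁻¹)) ⟨
      act c (x ⁻¹) -v c         ∎
      where
      open ≡-Reasoning
      k = proj₁ (ρ-Rep.index x)
      k≡ρx = proj₂ (ρ-Rep.index x)

    outer-verdict : ∀ {table} → Valid (f σ) (f τ) (outer table) → (∀ b → InImage M f b) × KerIsoF21 M f
    outer-verdict {table} certificate =
      f-onto , kernel≅F21 M (ρ-isRep M) ρ-injective (GL32 ∘ entry table) kernel-hom
                (λ t u → kernel-injective t u ∘ GL32-injective _ _) kernel⊆κ κ⊆kernel
      where
      open OuterCertificate certificate
      f-onto : ∀ b → InImage M f b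
      f-onto b =
        let k , k↦b  = onto b
            x , k≡ρx = ρ-onto k
        in x , trans (f-at k≡ρx) k↦b
      kernel⊆κ : ∀ x → f x ≡ 0v → ∃ λ t → GL32 (entry table t) ≡ ρ M x
      kernel⊆κ x fx≡0 =
        let k , k≡ρx = ρ-Rep.index x
            t , t↦k  = kernel-complete k (trans (sym (f-at k≡ρx)) fx≡0)
        in t , trans (cong GL32 t↦k) k≡ρx
      κ⊆kernel : ∀ t → ∃ λ x → f x ≡ 0v × ρ M x ≡ GL32 (entry table t)
      κ⊆kernel t = let x , t≡ρx = ρ-onto (entry table t) in x , trans (f-at t≡ρx) (kernel-sound t) , sym t≡ρx

    noninner-derivation : ¬ IsInner M f → (∀ b → InImage M f b) × KerIsoF21 M f
    noninner-derivation noninner with classify (f σ) (f τ) | classify-valid (f σ) (f τ)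
    ... | violates-relator | valid = ⊥-elim (valid relators-hold)
    ... | inner-by c       | valid = ⊥-elim (noninner (c , inner-by-verdict valid))
    ... | outer table      | valid = outer-verdict {table} valid

lemma7p6 : {c ℓ : Level} (G : Group c ℓ) → IsoGL32 G →
    (M : Module3 G) → Irreducible M →
    (f : Group.Carrier G → V3) → IsDerivation M f →
    ((IsInner M f → ¬ (∀ x → f x ≡ 0v) →
        HasCard (InImage M f) 7 × InImage M f 0v ×
        (∀ a → ¬ InImage M f a → IsInnerBy M f a))
     × (¬ IsInner M f → (∀ b → InImage M f b) × KerIsoF21 M f))
lemma7p6 G iso M irr f f-der = inner-derivation M (act-transitive iso M irr) , noninner-derivation iso M irr f-der
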